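{- Let $\ell>0$ be an integer and let $f(x)=x^\ell+a_1x^{\ell-1}+\cdots+a_\ell\in\mathbb{C}[x]$ be a monic complex polynomial of degree $\ell$. Then the following are equivalent: (a) $f(x)=A_\ell(x)$, the $\ell$-th Eulerian polynomial. (b) For every integer $m\geq 2$, \[ f(x^m)\equiv\left(\frac{1+x+\cdots+x^{m-1}}{m}\right)^{\ell+1}f(x)\mod (1-x)^{\ell+1}. \] (c) There exists an integer $m\geq 2$ such that \[ f(x^m)\equiv\left(\frac{1+x+\cdots+x^{m-1}}{m}\right)^{\ell+1}f(x)\mod (1-x)^{\ell+1}. \] (d) $f(x^2)\equiv\left(\frac{1+x}{2}\right)^{\ell+1}f(x)\mod (1-x)^{\ell+1}$.
   Context: For an integer $\ell\geq 1$, the Eulerian polynomial $A_\ell(x)$ is defined as the numerator of the rational function \[ \sum_{k=1}^\infty k^\ell x^k=\left(x\frac{d}{dx}\right)^\ell\frac{1}{1-x}=\frac{A_\ell(x)}{(1-x)^{\ell+1}}, \] i.e. $A_\ell(x)=(1-x)^{\ell+1}\sum_{k\geq 0}k^\ell x^k$; it is a monic polynomial of degree $\ell$ (e.g. $A_1=x$, $A_2=x+x^2$, $A_3=x+4x^2+x^3$). Congruences are in $\mathbb{C}[x]$: $p\equiv q \mod (1-x)^{\ell+1}$ means $(1-x)^{\ell+1}$ divides $p-q$. -}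

module Defs where

open import Level using (Level; _⊔_) renaming (suc to lsuc)
open import Algebra.Bundles using (CommutativeRing)
open import Data.Nat as ℕ using (ℕ; zero; suc; _∸_; _^_)
open import Data.List using (List; []; _∷_; _++_; map; replicate; foldr)
open import Data.Vec as Vec using (Vec)
open import Data.Product using (∃; Σ)
open import Relation.Nullary using (¬_)

-- Polynomials over a commutative ring R, represented by coefficient lists
-- (lowest degree first); equality is coefficientwise (so trailing zeros
-- do not matter).
module PolyOver {c ℓ} (R : CommutativeRing c ℓ) where
  open CommutativeRing R

  Poly : Set c
  Poly = List Carrier

  coeff : Poly → ℕ → Carrier
  coeff []       n       = 0#
  coeff (a ∷ p)  zero    = a
  coeff (a ∷ p)  (suc n) = coeff p n

  _≈ₚ_ : Poly → Poly → Set ℓ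
  p ≈ₚ q = ∀ n → coeff p n ≈ coeff q n

  infixl 6 _+ₚ_ _-ₚ_
  infixl 7 _*ₚ_

  _+ₚ_ : Poly → Poly → Poly
  []      +ₚ q       = q
  (a ∷ p) +ₚ []      = a ∷ p
  (a ∷ p) +ₚ (b ∷ q) = (a + b) ∷ (p +ₚ q)

  scale : Carrier → Poly → Poly
  scale a p = map (a *_) p

  negₚ : Poly → Poly
  negₚ p = map -_ p

  _-ₚ_ : Poly → Poly → Poly
  p -ₚ q = p +ₚ negₚ q

  _*ₚ_ : Poly → Poly → Poly
  []      *ₚ q = []
  (a ∷ p) *ₚ q = scale a q +ₚ (0# ∷ (p *ₚ q))

  constₚ : Carrier → Poly
  constₚ a = a ∷ []

  _^ₚ_ : Poly → ℕ → Poly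
  p ^ₚ zero  = constₚ 1#
  p ^ₚ suc n = p *ₚ (p ^ₚ n)

  monomial : ℕ → Poly
  monomial m = replicate m 0# ++ (1# ∷ [])

  compose : Poly → Poly → Poly
  compose p g = foldr (λ a acc → constₚ a +ₚ g *ₚ acc) [] p

  oneMinusX : Poly
  oneMinusX = 1# ∷ (- 1#) ∷ []

  geomSum : ℕ → Poly
  geomSum m = replicate m 1#

  _≡_mod_ : Poly → Poly → Poly → Set (c ⊔ ℓ)
  p ≡ q mod d = ∃ λ r → (p -ₚ q) ≈ₚ (d *ₚ r)

  fromℕ : ℕ → Carrier
  fromℕ zero    = 0#
  fromℕ (suc n) = 1# + fromℕ n

  monic : (l : ℕ) → Vec Carrier l → Poly
  monic l cs = Vec.toList cs ++ (1# ∷ [])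

  sumUpTo : ℕ → (ℕ → Carrier) → Carrier
  sumUpTo zero    g = g 0
  sumUpTo (suc n) g = sumUpTo n g + g (suc n)

  -- n-th coefficient of the formal power series
  --   A_l(x) = (1-x)^(l+1) · Σ_{k≥0} k^l x^k     (Eulerian polynomial)
  eulerianCoeff : ℕ → ℕ → Carrier
  eulerianCoeff l n =
    sumUpTo n (λ j → coeff (oneMinusX ^ₚ suc l) j * fromℕ ((n ∸ j) ^ l))

  IsEulerian : ℕ → Poly → Set ℓ
  IsEulerian l f = ∀ n → coeff f n ≈ eulerianCoeff l n

  -- the congruence  f(x^m) ≡ (minv·(1+x+...+x^(m-1)))^(l+1) f(x) mod (1-x)^(l+1),
  -- where minv is (intended to be) the inverse of m
  Cong : ℕ → Poly → ℕ → Carrier → Set (c ⊔ ℓ)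
  Cong l f m minv =
    compose f (monomial m)
      ≡ (scale minv (geomSum m) ^ₚ suc l) *ₚ f
      mod (oneMinusX ^ₚ suc l)

record CharZeroField (c ℓ : Level) : Set (lsuc (c ⊔ ℓ)) where
  field
    commutativeRing : CommutativeRing c ℓ
  open CommutativeRing commutativeRing
  open PolyOver commutativeRing using (fromℕ)
  field
    inverse   : ∀ x → ¬ (x ≈ 0#) → Σ Carrier λ y → x * y ≈ 1#
    charZero  : ∀ n → ¬ (fromℕ (suc n) ≈ 0#)

-- Write C f = f(x^m), G = 1 + x + ... + x^(m-1), P = G/m and θ = x d/dx. The Eulerian polynomials
-- satisfy A_0 = 1 and A_(l+1) = (1 - x) θ A_l + (l + 1) x A_l. Since θ (C f) = m C (θ f) and
-- C (1 - x) = (1 - x) G, the congruence C A_l ≡ P^(l+1) A_l mod (1 - x)^(l+1) propagates from l to l + 1,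
-- for every m. Conversely, the solutions of the congruence form a linear space. If a solution p
-- vanishes at 1 and p = (1 - x)^j w with j ≤ l, cancelling (1 - x)^j and evaluating at 1 gives
-- (m^j - 1) w(1) = 0, so w(1) = 0 when m ≥ 2 in characteristic 0, and (1 - x)^(j+1) divides p.
-- So a solution of degree ≤ l vanishing at 1 is zero. For a monic solution f, h = f - A_l has
-- degree < l, and h(1) A_l - A_l(1) h is such a solution whose x^l coefficient is h(1); hence h(1) = 0
-- and then h = 0.
module Submission where

open import Defs
open import Level using (_⊔_)
open import Algebra.Bundles using (CommutativeRing; Semiring)
open import Algebra.Solver.Ring.AlmostCommutativeRing
  using (AlmostCommutativeRing; fromCommutativeRing; _-Raw-AlmostCommutative⟶_)
open import Data.Nat as ℕ using (ℕ; zero; suc; _≤_; _<_; s≤s; z≤n)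
import Data.Nat.Properties as ℕₚ
open import Data.Integer as ℤ using (ℤ; +_; -[1+_])
import Data.Integer.Properties as ℤₚ
open import Data.Sign as Sign using (Sign)
open import Data.Maybe using (Maybe; just; nothing)
open import Data.List using ([]; _∷_; length)
open import Data.Vec as Vec using (Vec)
open import Data.Product using (Σ; _×_; _,_; ∃; proj₁; proj₂)
open import Function.Bundles using (_⇔_; mk⇔)
open import Relation.Nullary using (yes; no; ¬_)
open import Relation.Binary.PropositionalEquality as ≡ using (_≡_)
open import Relation.Binary.Bundles using (Setoid)
import Relation.Binary.Reasoning.Setoid as SetoidReasoning

module CR = CommutativeRing

-- The ring solver needs coefficients with decidable equality: we use ℤ, mapped into R.
module IntegerSolver {c ℓ} (R : CommutativeRing c ℓ) where
  open CommutativeRing R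
  open PolyOver R using (fromℕ)
  open import Algebra.Properties.Ring ring using (-‿distribˡ-*; -‿involutive; -0#≈0#)
  open import Algebra.Properties.AbelianGroup +-abelianGroup using (⁻¹-∙-comm)
  open SetoidReasoning setoid

  fromℕ-+ : ∀ m n → fromℕ (m ℕ.+ n) ≈ fromℕ m + fromℕ n
  fromℕ-+ zero    n = sym (+-identityˡ _)
  fromℕ-+ (suc m) n = trans (+-congˡ (fromℕ-+ m n)) (sym (+-assoc _ _ _))

  fromℕ-* : ∀ m n → fromℕ (m ℕ.* n) ≈ fromℕ m * fromℕ n
  fromℕ-* zero    n = sym (zeroˡ _)
  fromℕ-* (suc m) n = begin
    fromℕ (n ℕ.+ m ℕ.* n)            ≈⟨ fromℕ-+ n (m ℕ.* n) ⟩
    fromℕ n + fromℕ (m ℕ.* n)        ≈⟨ +-cong (sym (*-identityˡ _)) (fromℕ-* m n) ⟩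
    1# * fromℕ n + fromℕ m * fromℕ n ≈⟨ distribʳ _ _ _ ⟨
    (1# + fromℕ m) * fromℕ n         ∎

  ⟦_⟧ℤ : ℤ → Carrier
  ⟦ + n      ⟧ℤ = fromℕ n
  ⟦ -[1+ n ] ⟧ℤ = - fromℕ (suc n)

  ⟦_⟧sign : Sign → Carrier
  ⟦ Sign.+ ⟧sign = 1#
  ⟦ Sign.- ⟧sign = - 1#

  ⟦-⟧ℤ : ∀ i → ⟦ ℤ.- i ⟧ℤ ≈ - ⟦ i ⟧ℤ
  ⟦-⟧ℤ (+ zero)  = sym -0#≈0#
  ⟦-⟧ℤ (+ suc n) = refl
  ⟦-⟧ℤ -[1+ n ]  = sym (-‿involutive _)

  1+m-1+n≈m-n : ∀ a b → (1# + a) - (1# + b) ≈ a - b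
  1+m-1+n≈m-n a b = begin
    (1# + a) + - (1# + b)   ≈⟨ +-congˡ (⁻¹-∙-comm 1# b) ⟨
    (1# + a) + (- 1# + - b) ≈⟨ +-congʳ (+-comm 1# a) ⟩
    (a + 1#) + (- 1# + - b) ≈⟨ +-assoc a 1# _ ⟩
    a + (1# + (- 1# + - b)) ≈⟨ +-congˡ (+-assoc 1# (- 1#) _) ⟨
    a + ((1# - 1#) + - b)   ≈⟨ +-congˡ (+-congʳ (-‿inverseʳ 1#)) ⟩
    a + (0# + - b)          ≈⟨ +-congˡ (+-identityˡ _) ⟩
    a - b                   ∎

  ⟦⊖⟧ℤ : ∀ m n → ⟦ m ℤ.⊖ n ⟧ℤ ≈ fromℕ m - fromℕ n
  ⟦⊖⟧ℤ zero    zero    = sym (-‿inverseʳ 0#)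
  ⟦⊖⟧ℤ (suc m) zero    = sym (trans (+-congˡ -0#≈0#) (+-identityʳ _))
  ⟦⊖⟧ℤ zero    (suc n) = sym (+-identityˡ _)
  ⟦⊖⟧ℤ (suc m) (suc n) = begin
    ⟦ suc m ℤ.⊖ suc n ⟧ℤ ≈⟨ reflexive (≡.cong ⟦_⟧ℤ (ℤₚ.[1+m]⊖[1+n]≡m⊖n m n)) ⟩
    ⟦ m ℤ.⊖ n ⟧ℤ         ≈⟨ ⟦⊖⟧ℤ m n ⟩
    fromℕ m - fromℕ n    ≈⟨ 1+m-1+n≈m-n (fromℕ m) (fromℕ n) ⟨
    fromℕ (suc m) - fromℕ (suc n) ∎

  ⟦+⟧ℤ : ∀ i j → ⟦ i ℤ.+ j ⟧ℤ ≈ ⟦ i ⟧ℤ + ⟦ j ⟧ℤ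
  ⟦+⟧ℤ (+ m)    (+ n)    = fromℕ-+ m n
  ⟦+⟧ℤ (+ m)    -[1+ n ] = ⟦⊖⟧ℤ m (suc n)
  ⟦+⟧ℤ -[1+ m ] (+ n)    = trans (⟦⊖⟧ℤ n (suc m)) (+-comm _ _)
  ⟦+⟧ℤ -[1+ m ] -[1+ n ] = begin
    - fromℕ (suc (suc m) ℕ.+ n)       ≈⟨ -‿cong (fromℕ-+ (suc (suc m)) n) ⟩
    - ((1# + fromℕ (suc m)) + fromℕ n) ≈⟨ -‿cong (+-congʳ (+-comm _ _)) ⟩
    - ((fromℕ (suc m) + 1#) + fromℕ n) ≈⟨ -‿cong (+-assoc _ _ _) ⟩
    - (fromℕ (suc m) + fromℕ (suc n))  ≈⟨ ⁻¹-∙-comm _ _ ⟨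
    - fromℕ (suc m) + - fromℕ (suc n)  ∎

  ⟦◃⟧ℤ : ∀ s n → ⟦ s ℤ.◃ n ⟧ℤ ≈ ⟦ s ⟧sign * fromℕ n
  ⟦◃⟧ℤ s        zero    = sym (zeroʳ _)
  ⟦◃⟧ℤ Sign.+ (suc n) = sym (*-identityˡ _)
  ⟦◃⟧ℤ Sign.- (suc n) = trans (-‿cong (sym (*-identityˡ _))) (-‿distribˡ-* 1# _)

  ⟦sign*abs⟧ℤ : ∀ i → ⟦ i ⟧ℤ ≈ ⟦ ℤ.sign i ⟧sign * fromℕ ℤ.∣ i ∣
  ⟦sign*abs⟧ℤ (+ n)    = sym (*-identityˡ _)
  ⟦sign*abs⟧ℤ -[1+ n ] = trans (-‿cong (sym (*-identityˡ _))) (-‿distribˡ-* 1# _)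

  ⟦*⟧sign : ∀ s t → ⟦ s Sign.* t ⟧sign ≈ ⟦ s ⟧sign * ⟦ t ⟧sign
  ⟦*⟧sign Sign.+ t      = sym (*-identityˡ _)
  ⟦*⟧sign Sign.- Sign.+ = sym (*-identityʳ _)
  ⟦*⟧sign Sign.- Sign.- = begin
    1#            ≈⟨ -‿involutive 1# ⟨
    - - 1#        ≈⟨ -‿cong (*-identityˡ _) ⟨
    - (1# * - 1#) ≈⟨ -‿distribˡ-* 1# _ ⟩
    - 1# * - 1#   ∎

  ⟦*⟧ℤ : ∀ i j → ⟦ i ℤ.* j ⟧ℤ ≈ ⟦ i ⟧ℤ * ⟦ j ⟧ℤ
  ⟦*⟧ℤ i j = begin
    ⟦ ℤ.sign i Sign.* ℤ.sign j ℤ.◃ ℤ.∣ i ∣ ℕ.* ℤ.∣ j ∣ ⟧ℤ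
      ≈⟨ ⟦◃⟧ℤ (ℤ.sign i Sign.* ℤ.sign j) (ℤ.∣ i ∣ ℕ.* ℤ.∣ j ∣) ⟩
    ⟦ ℤ.sign i Sign.* ℤ.sign j ⟧sign * fromℕ (ℤ.∣ i ∣ ℕ.* ℤ.∣ j ∣)
      ≈⟨ *-cong (⟦*⟧sign (ℤ.sign i) (ℤ.sign j)) (fromℕ-* ℤ.∣ i ∣ ℤ.∣ j ∣) ⟩
    (si * sj) * (ni * nj) ≈⟨ *-assoc si sj _ ⟩
    si * (sj * (ni * nj)) ≈⟨ *-congˡ (*-assoc sj ni nj) ⟨
    si * ((sj * ni) * nj) ≈⟨ *-congˡ (*-congʳ (*-comm sj ni)) ⟩
    si * ((ni * sj) * nj) ≈⟨ *-congˡ (*-assoc ni sj nj) ⟩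
    si * (ni * (sj * nj)) ≈⟨ *-assoc si ni _ ⟨
    (si * ni) * (sj * nj) ≈⟨ *-cong (⟦sign*abs⟧ℤ i) (⟦sign*abs⟧ℤ j) ⟨
    ⟦ i ⟧ℤ * ⟦ j ⟧ℤ        ∎
    where
    si = ⟦ ℤ.sign i ⟧sign
    sj = ⟦ ℤ.sign j ⟧sign
    ni = fromℕ ℤ.∣ i ∣
    nj = fromℕ ℤ.∣ j ∣

  ℤ⟶R : ℤ.+-*-rawRing -Raw-AlmostCommutative⟶ fromCommutativeRing R
  ℤ⟶R = record
    { ⟦_⟧    = ⟦_⟧ℤ
    ; +-homo = ⟦+⟧ℤ
    ; *-homo = ⟦*⟧ℤ
    ; -‿homo = ⟦-⟧ℤ
    ; 0-homo = refl
    ; 1-homo = +-identityʳ 1#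
    }

  ⟦⟧ℤ-≟ : ∀ i j → Maybe (⟦ i ⟧ℤ ≈ ⟦ j ⟧ℤ)
  ⟦⟧ℤ-≟ i j with i ℤ.≟ j
  ... | yes ≡.refl = just refl
  ... | no _       = nothing

  open import Algebra.Solver.Ring ℤ.+-*-rawRing (fromCommutativeRing R) ℤ⟶R ⟦⟧ℤ-≟ public

module PolynomialRing {c ℓ} (R : CommutativeRing c ℓ) where
  open CommutativeRing R
  open PolyOver R
  open import Algebra.Properties.Ring ring using (-‿distribˡ-*; -0#≈0#)
  open import Algebra.Properties.CommutativeSemigroup +-commutativeSemigroup using (interchange)

  -- Coefficientwise equality as a record, so that the two polynomials can be inferred.
  infix 4 _≋_
  record _≋_ (p q : Poly) : Set ℓ where
    constructor ⟨_⟩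
    field at : ∀ n → coeff p n ≈ coeff q n
  open _≋_ public

  ≋-refl : ∀ {p} → p ≋ p
  ≋-refl = ⟨ (λ n → refl) ⟩

  ≋-sym : ∀ {p q} → p ≋ q → q ≋ p
  ≋-sym e = ⟨ (λ n → sym (at e n)) ⟩

  ≋-trans : ∀ {p q r} → p ≋ q → q ≋ r → p ≋ r
  ≋-trans e f = ⟨ (λ n → trans (at e n) (at f n)) ⟩

  ≋-setoid : Setoid c ℓ
  ≋-setoid = record
    { Carrier = Poly
    ; _≈_ = _≋_
    ; isEquivalence = record { refl = ≋-refl ; sym = ≋-sym ; trans = ≋-trans }
    }

  module ≋-Reasoning = SetoidReasoning ≋-setoid

  coeff-+ : ∀ p q n → coeff (p +ₚ q) n ≈ coeff p n + coeff q n
  coeff-+ []      q       n       = sym (+-identityˡ _)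
  coeff-+ (a ∷ p) []      n       = sym (+-identityʳ _)
  coeff-+ (a ∷ p) (b ∷ q) zero    = refl
  coeff-+ (a ∷ p) (b ∷ q) (suc n) = coeff-+ p q n

  coeff-scale : ∀ a p n → coeff (scale a p) n ≈ a * coeff p n
  coeff-scale a []      n       = sym (zeroʳ _)
  coeff-scale a (b ∷ p) zero    = refl
  coeff-scale a (b ∷ p) (suc n) = coeff-scale a p n

  coeff-neg : ∀ p n → coeff (negₚ p) n ≈ - coeff p n
  coeff-neg []      n       = sym -0#≈0#
  coeff-neg (b ∷ p) zero    = refl
  coeff-neg (b ∷ p) (suc n) = coeff-neg p n

  coeff-- : ∀ p q n → coeff (p -ₚ q) n ≈ coeff p n - coeff q n
  coeff-- p q n = trans (coeff-+ p (negₚ q) n) (+-congˡ (coeff-neg q n))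

  +ₚ-cong : ∀ {p p′ q q′} → p ≋ p′ → q ≋ q′ → p +ₚ q ≋ p′ +ₚ q′
  +ₚ-cong {p} {p′} {q} {q′} e f = ⟨ (λ n → begin
    coeff (p +ₚ q) n     ≈⟨ coeff-+ p q n ⟩
    coeff p n + coeff q n ≈⟨ +-cong (at e n) (at f n) ⟩
    coeff p′ n + coeff q′ n ≈⟨ coeff-+ p′ q′ n ⟨
    coeff (p′ +ₚ q′) n   ∎) ⟩
    where
    open SetoidReasoning setoid

  +ₚ-assoc : ∀ p q r → (p +ₚ q) +ₚ r ≋ p +ₚ (q +ₚ r)
  +ₚ-assoc p q r = ⟨ (λ n → begin
    coeff ((p +ₚ q) +ₚ r) n                 ≈⟨ trans (coeff-+ (p +ₚ q) r n) (+-congʳ (coeff-+ p q n)) ⟩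
    (coeff p n + coeff q n) + coeff r n    ≈⟨ +-assoc _ _ _ ⟩
    coeff p n + (coeff q n + coeff r n)    ≈⟨ trans (coeff-+ p (q +ₚ r) n) (+-congˡ (coeff-+ q r n)) ⟨
    coeff (p +ₚ (q +ₚ r)) n                 ∎) ⟩
    where
    open SetoidReasoning setoid

  +ₚ-comm : ∀ p q → p +ₚ q ≋ q +ₚ p
  +ₚ-comm p q = ⟨ (λ n → trans (coeff-+ p q n) (trans (+-comm _ _) (sym (coeff-+ q p n)))) ⟩

  +ₚ-identityʳ : ∀ p → p +ₚ [] ≋ p
  +ₚ-identityʳ p = ⟨ (λ n → trans (coeff-+ p [] n) (+-identityʳ _)) ⟩

  +ₚ-interchange : ∀ p q r s → (p +ₚ q) +ₚ (r +ₚ s) ≋ (p +ₚ r) +ₚ (q +ₚ s)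
  +ₚ-interchange p q r s = ⟨ (λ n → begin
    coeff ((p +ₚ q) +ₚ (r +ₚ s)) n
      ≈⟨ trans (coeff-+ (p +ₚ q) _ n) (+-cong (coeff-+ p q n) (coeff-+ r s n)) ⟩
    (coeff p n + coeff q n) + (coeff r n + coeff s n)
      ≈⟨ interchange _ _ _ _ ⟩
    (coeff p n + coeff r n) + (coeff q n + coeff s n)
      ≈⟨ trans (coeff-+ (p +ₚ r) _ n) (+-cong (coeff-+ p r n) (coeff-+ q s n)) ⟨
    coeff ((p +ₚ r) +ₚ (q +ₚ s)) n ∎) ⟩
    where
    open SetoidReasoning setoid

  +ₚ-congˡ : ∀ p {q q′} → q ≋ q′ → p +ₚ q ≋ p +ₚ q′
  +ₚ-congˡ p e = +ₚ-cong (≋-refl {p}) e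

  +ₚ-congʳ : ∀ {p p′} q → p ≋ p′ → p +ₚ q ≋ p′ +ₚ q
  +ₚ-congʳ q e = +ₚ-cong e (≋-refl {q})

  negₚ-cong : ∀ {p q} → p ≋ q → negₚ p ≋ negₚ q
  negₚ-cong {p} {q} e = ⟨ (λ n → trans (coeff-neg p n) (trans (-‿cong (at e n)) (sym (coeff-neg q n)))) ⟩

  negₚ-inverseˡ : ∀ p → negₚ p +ₚ p ≋ []
  negₚ-inverseˡ p = ⟨ (λ n → trans (coeff-+ (negₚ p) p n) (trans (+-congʳ (coeff-neg p n)) (-‿inverseˡ _))) ⟩

  negₚ-inverseʳ : ∀ p → p +ₚ negₚ p ≋ []
  negₚ-inverseʳ p = ⟨ (λ n → trans (coeff-+ p (negₚ p) n) (trans (+-congˡ (coeff-neg p n)) (-‿inverseʳ _))) ⟩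

  ∷-cong : ∀ {a b p q} → a ≈ b → p ≋ q → a ∷ p ≋ b ∷ q
  ∷-cong e f = ⟨ (λ { zero → e ; (suc n) → at f n }) ⟩

  0∷[]≋[] : 0# ∷ [] ≋ []
  0∷[]≋[] = ⟨ (λ { zero → refl ; (suc n) → refl }) ⟩

  scale-cong : ∀ {a b p q} → a ≈ b → p ≋ q → scale a p ≋ scale b q
  scale-cong {a} {b} {p} {q} e f =
    ⟨ (λ n → trans (coeff-scale a p n) (trans (*-cong e (at f n)) (sym (coeff-scale b q n)))) ⟩

  scale-distribˡ : ∀ a p q → scale a (p +ₚ q) ≋ scale a p +ₚ scale a q
  scale-distribˡ a p q = ⟨ (λ n → begin
    coeff (scale a (p +ₚ q)) n   ≈⟨ trans (coeff-scale a (p +ₚ q) n) (*-congˡ (coeff-+ p q n)) ⟩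
    a * (coeff p n + coeff q n) ≈⟨ distribˡ _ _ _ ⟩
    a * coeff p n + a * coeff q n ≈⟨ trans (coeff-+ (scale a p) (scale a q) n) (+-cong (coeff-scale a p n) (coeff-scale a q n)) ⟨
    coeff (scale a p +ₚ scale a q) n ∎) ⟩
    where
    open SetoidReasoning setoid

  scale-distribʳ : ∀ a b p → scale (a + b) p ≋ scale a p +ₚ scale b p
  scale-distribʳ a b p = ⟨ (λ n → begin
    coeff (scale (a + b) p) n    ≈⟨ coeff-scale _ p n ⟩
    (a + b) * coeff p n         ≈⟨ distribʳ _ _ _ ⟩
    a * coeff p n + b * coeff p n ≈⟨ trans (coeff-+ (scale a p) (scale b p) n) (+-cong (coeff-scale a p n) (coeff-scale b p n)) ⟨
    coeff (scale a p +ₚ scale b p) n ∎) ⟩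
    where
    open SetoidReasoning setoid

  scale-assoc : ∀ a b p → scale (a * b) p ≋ scale a (scale b p)
  scale-assoc a b p = ⟨ (λ n → trans (coeff-scale _ p n) (trans (*-assoc _ _ _)
    (sym (trans (coeff-scale a (scale b p) n) (*-congˡ (coeff-scale b p n)))))) ⟩

  scale-identity : ∀ p → scale 1# p ≋ p
  scale-identity p = ⟨ (λ n → trans (coeff-scale _ p n) (*-identityˡ _)) ⟩

  scale-zero : ∀ p → scale 0# p ≋ []
  scale-zero p = ⟨ (λ n → trans (coeff-scale _ p n) (zeroˡ _)) ⟩

  *ₚ-zeroʳ : ∀ p → p *ₚ [] ≋ []
  *ₚ-zeroʳ []      = ≋-refl
  *ₚ-zeroʳ (a ∷ p) = ≋-trans (∷-cong refl (*ₚ-zeroʳ p)) 0∷[]≋[]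

  *ₚ-congˡ : ∀ p {q q′} → q ≋ q′ → p *ₚ q ≋ p *ₚ q′
  *ₚ-congˡ []      e = ≋-refl
  *ₚ-congˡ (a ∷ p) e = +ₚ-cong (scale-cong refl e) (∷-cong refl (*ₚ-congˡ p e))

  *ₚ-distribˡ : ∀ p q r → p *ₚ (q +ₚ r) ≋ p *ₚ q +ₚ p *ₚ r
  *ₚ-distribˡ []      q r = ≋-refl
  *ₚ-distribˡ (a ∷ p) q r = ≋-trans
    (+ₚ-cong (scale-distribˡ a q r) (∷-cong (sym (+-identityʳ 0#)) (*ₚ-distribˡ p q r)))
    (+ₚ-interchange (scale a q) (scale a r) (0# ∷ (p *ₚ q)) (0# ∷ (p *ₚ r)))

  *ₚ-distribʳ : ∀ p q r → (q +ₚ r) *ₚ p ≋ q *ₚ p +ₚ r *ₚ p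
  *ₚ-distribʳ p []      r       = ≋-refl
  *ₚ-distribʳ p (a ∷ q) []      = ≋-sym (+ₚ-identityʳ _)
  *ₚ-distribʳ p (a ∷ q) (b ∷ r) = ≋-trans
    (+ₚ-cong (scale-distribʳ a b p) (∷-cong (sym (+-identityʳ 0#)) (*ₚ-distribʳ p q r)))
    (+ₚ-interchange (scale a p) (scale b p) (0# ∷ (q *ₚ p)) (0# ∷ (r *ₚ p)))

  scale-*ₚ : ∀ a p q → scale a p *ₚ q ≋ scale a (p *ₚ q)
  scale-*ₚ a []      q = ≋-refl
  scale-*ₚ a (b ∷ p) q = ≋-trans
    (+ₚ-cong (scale-assoc a b q) (∷-cong (sym (zeroʳ a)) (scale-*ₚ a p q)))
    (≋-sym (scale-distribˡ a (scale b q) (0# ∷ (p *ₚ q))))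

  *ₚ-0∷ : ∀ p q → p *ₚ (0# ∷ q) ≋ 0# ∷ (p *ₚ q)
  *ₚ-0∷ []      q = ≋-sym 0∷[]≋[]
  *ₚ-0∷ (a ∷ p) q = ∷-cong (trans (+-identityʳ _) (zeroʳ a)) (+ₚ-cong ≋-refl (*ₚ-0∷ p q))

  0∷-*ₚ : ∀ p q → (0# ∷ p) *ₚ q ≋ 0# ∷ (p *ₚ q)
  0∷-*ₚ p q = +ₚ-cong (scale-zero q) ≋-refl

  *ₚ-constₚ : ∀ p a → p *ₚ constₚ a ≋ scale a p
  *ₚ-constₚ []      a = ≋-refl
  *ₚ-constₚ (b ∷ p) a = ∷-cong (trans (+-identityʳ _) (*-comm b a)) (*ₚ-constₚ p a)

  ∷-split : ∀ a p → a ∷ p ≋ constₚ a +ₚ (0# ∷ p)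
  ∷-split a p = ⟨ (λ { zero → sym (+-identityʳ a) ; (suc n) → refl }) ⟩

  *ₚ-comm : ∀ p q → p *ₚ q ≋ q *ₚ p
  *ₚ-comm []      q = ≋-sym (*ₚ-zeroʳ q)
  *ₚ-comm (a ∷ p) q = begin
    scale a q +ₚ (0# ∷ (p *ₚ q))     ≈⟨ +ₚ-cong (≋-sym (*ₚ-constₚ q a)) (∷-cong refl (*ₚ-comm p q)) ⟩
    q *ₚ constₚ a +ₚ (0# ∷ (q *ₚ p)) ≈⟨ +ₚ-cong ≋-refl (*ₚ-0∷ q p) ⟨
    q *ₚ constₚ a +ₚ q *ₚ (0# ∷ p)   ≈⟨ *ₚ-distribˡ q (constₚ a) (0# ∷ p) ⟨
    q *ₚ (constₚ a +ₚ (0# ∷ p))      ≈⟨ *ₚ-congˡ q (∷-split a p) ⟨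
    q *ₚ (a ∷ p)                     ∎
    where
    open ≋-Reasoning

  *ₚ-congʳ : ∀ {p p′} q → p ≋ p′ → p *ₚ q ≋ p′ *ₚ q
  *ₚ-congʳ {p} {p′} q e = ≋-trans (*ₚ-comm p q) (≋-trans (*ₚ-congˡ q e) (*ₚ-comm q p′))

  *ₚ-cong : ∀ {p p′ q q′} → p ≋ p′ → q ≋ q′ → p *ₚ q ≋ p′ *ₚ q′
  *ₚ-cong {p} {p′} {q} {q′} e f = ≋-trans (*ₚ-congʳ q e) (*ₚ-congˡ p′ f)

  *ₚ-assoc : ∀ p q r → (p *ₚ q) *ₚ r ≋ p *ₚ (q *ₚ r)
  *ₚ-assoc []      q r = ≋-refl
  *ₚ-assoc (a ∷ p) q r = ≋-trans (*ₚ-distribʳ r (scale a q) (0# ∷ (p *ₚ q)))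
    (+ₚ-cong (scale-*ₚ a q r) (≋-trans (0∷-*ₚ (p *ₚ q) r) (∷-cong refl (*ₚ-assoc p q r))))

  *ₚ-identityˡ : ∀ p → constₚ 1# *ₚ p ≋ p
  *ₚ-identityˡ p = ≋-trans (+ₚ-cong (scale-identity p) 0∷[]≋[]) (+ₚ-identityʳ p)

  *ₚ-identityʳ : ∀ p → p *ₚ constₚ 1# ≋ p
  *ₚ-identityʳ p = ≋-trans (*ₚ-comm p _) (*ₚ-identityˡ p)

  polyRing : CommutativeRing c ℓ
  polyRing = record
    { Carrier = Poly
    ; _≈_ = _≋_
    ; _+_ = _+ₚ_
    ; _*_ = _*ₚ_
    ; -_ = negₚ
    ; 0# = []
    ; 1# = constₚ 1#
    ; isCommutativeRing = record
      { isRing = record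
        { +-isAbelianGroup = record
          { isGroup = record
            { isMonoid = record
              { isSemigroup = record
                { isMagma = record
                  { isEquivalence = Setoid.isEquivalence ≋-setoid
                  ; ∙-cong = +ₚ-cong }
                ; assoc = +ₚ-assoc }
              ; identity = (λ p → ≋-refl) , +ₚ-identityʳ }
            ; inverse = negₚ-inverseˡ , negₚ-inverseʳ
            ; ⁻¹-cong = negₚ-cong }
          ; comm = +ₚ-comm }
        ; *-cong = *ₚ-cong
        ; *-assoc = *ₚ-assoc
        ; *-identity = *ₚ-identityˡ , *ₚ-identityʳ
        ; distrib = *ₚ-distribˡ , *ₚ-distribʳ }
      ; *-comm = *ₚ-comm } }

module PolynomialCalculus {c ℓ} (R : CommutativeRing c ℓ) where
  open CommutativeRing R
  open PolyOver R
  open PolynomialRing R public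
  open IntegerSolver R using (fromℕ-*)
  open IntegerSolver polyRing public using (solve; _:+_; _:*_; _:-_; :-_; _:=_; con)
  open import Algebra.Definitions.RawSemiring (Semiring.rawSemiring semiring) using (_^_)
  open import Algebra.Properties.Ring ring using (-‿distribʳ-*; -0#≈0#)
  open import Algebra.Properties.AbelianGroup +-abelianGroup using (⁻¹-∙-comm)
  open import Algebra.Properties.Group +-group using () renaming (x∙y⁻¹≈ε⇒x≈y to ≈-by-difference)
  open import Algebra.Properties.Group (CommutativeRing.+-group polyRing) public
    using () renaming (x∙y⁻¹≈ε⇒x≈y to ≋-by-difference)

  1ₚ : Poly
  1ₚ = constₚ 1#

  xₚ : Poly
  xₚ = 0# ∷ 1# ∷ []

  U : Poly
  U = 1ₚ -ₚ xₚ

  -ₚ≋⇒≋+ₚ : ∀ {p q d} → p -ₚ q ≋ d → p ≋ q +ₚ d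
  -ₚ≋⇒≋+ₚ {p} {q} e = ≋-trans (solve 2 (λ p q → p := q :+ (p :- q)) ≋-refl p q) (+ₚ-congˡ q e)

  ≋+ₚ⇒-ₚ≋ : ∀ {p q d} → p ≋ q +ₚ d → p -ₚ q ≋ d
  ≋+ₚ⇒-ₚ≋ {p} {q} {d} e = ≋-trans (+ₚ-congʳ (negₚ q) e) (solve 2 (λ q d → (q :+ d) :- q := d) ≋-refl q d)

  infix 4 _∣ₚ_
  _∣ₚ_ : Poly → Poly → Set (c ⊔ ℓ)
  d ∣ₚ p = ∃ λ q → p ≋ d *ₚ q

  0∷≋xₚ*ₚ : ∀ p → 0# ∷ p ≋ xₚ *ₚ p
  0∷≋xₚ*ₚ p = ≋-sym (+ₚ-cong (scale-zero p) (∷-cong refl (*ₚ-identityˡ p)))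

  ∷≋constₚ+xₚ*ₚ : ∀ a p → a ∷ p ≋ constₚ a +ₚ xₚ *ₚ p
  ∷≋constₚ+xₚ*ₚ a p = ≋-trans (∷-split a p) (+ₚ-congˡ (constₚ a) (0∷≋xₚ*ₚ p))

  scale≋constₚ*ₚ : ∀ a p → scale a p ≋ constₚ a *ₚ p
  scale≋constₚ*ₚ a p = ≋-sym (≋-trans (+ₚ-congˡ (scale a p) 0∷[]≋[]) (+ₚ-identityʳ _))

  constₚ-cong : ∀ {a b} → a ≈ b → constₚ a ≋ constₚ b
  constₚ-cong e = ∷-cong e ≋-refl

  constₚ-* : ∀ a b → constₚ (a * b) ≋ constₚ a *ₚ constₚ b
  constₚ-* a b = ⟨ (λ { zero → sym (+-identityʳ _) ; (suc n) → refl }) ⟩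

  oneMinusX≋U : oneMinusX ≋ U
  oneMinusX≋U = ⟨ (λ { zero          → sym (trans (+-congˡ -0#≈0#) (+-identityʳ _))
                     ; (suc zero)    → refl
                     ; (suc (suc n)) → refl }) ⟩

  ^ₚ-cong : ∀ {p q} n → p ≋ q → p ^ₚ n ≋ q ^ₚ n
  ^ₚ-cong zero    e = ≋-refl
  ^ₚ-cong {p} {q} (suc n) e = ≋-trans (*ₚ-congʳ (p ^ₚ n) e) (*ₚ-congˡ q (^ₚ-cong n e))

  ^ₚ-homo-+ : ∀ p a b → p ^ₚ (a ℕ.+ b) ≋ p ^ₚ a *ₚ p ^ₚ b
  ^ₚ-homo-+ p zero    b = ≋-sym (*ₚ-identityˡ _)
  ^ₚ-homo-+ p (suc a) b = ≋-trans (*ₚ-congˡ p (^ₚ-homo-+ p a b)) (≋-sym (*ₚ-assoc p (p ^ₚ a) (p ^ₚ b)))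

  ^ₚ-distrib-*ₚ : ∀ p q n → (p *ₚ q) ^ₚ n ≋ p ^ₚ n *ₚ q ^ₚ n
  ^ₚ-distrib-*ₚ p q zero    = ≋-sym (*ₚ-identityˡ 1ₚ)
  ^ₚ-distrib-*ₚ p q (suc n) = ≋-trans (*ₚ-congˡ (p *ₚ q) (^ₚ-distrib-*ₚ p q n))
    (solve 4 (λ p q P Q → (p :* q) :* (P :* Q) := (p :* P) :* (q :* Q)) ≋-refl p q (p ^ₚ n) (q ^ₚ n))

  -- The Euler operator θ = x d/dx.
  θ : Poly → Poly
  θ []      = []
  θ (a ∷ p) = 0# ∷ (p +ₚ θ p)

  coeff-θ : ∀ p n → coeff (θ p) n ≈ fromℕ n * coeff p n
  coeff-θ []      n       = sym (zeroʳ _)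
  coeff-θ (a ∷ p) zero    = sym (zeroˡ _)
  coeff-θ (a ∷ p) (suc n) = begin
    coeff (p +ₚ θ p) n                 ≈⟨ coeff-+ p (θ p) n ⟩
    coeff p n + coeff (θ p) n          ≈⟨ +-cong (sym (*-identityˡ _)) (coeff-θ p n) ⟩
    1# * coeff p n + fromℕ n * coeff p n ≈⟨ distribʳ _ _ _ ⟨
    (1# + fromℕ n) * coeff p n         ∎
    where
    open SetoidReasoning setoid

  θ-cong : ∀ {p q} → p ≋ q → θ p ≋ θ q
  θ-cong {p} {q} e = ⟨ (λ n → trans (coeff-θ p n) (trans (*-congˡ (at e n)) (sym (coeff-θ q n)))) ⟩

  θ-+ : ∀ p q → θ (p +ₚ q) ≋ θ p +ₚ θ q
  θ-+ p q = ⟨ (λ n → begin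
    coeff (θ (p +ₚ q)) n                        ≈⟨ trans (coeff-θ (p +ₚ q) n) (*-congˡ (coeff-+ p q n)) ⟩
    fromℕ n * (coeff p n + coeff q n)           ≈⟨ distribˡ _ _ _ ⟩
    fromℕ n * coeff p n + fromℕ n * coeff q n   ≈⟨ trans (coeff-+ (θ p) (θ q) n) (+-cong (coeff-θ p n) (coeff-θ q n)) ⟨
    coeff (θ p +ₚ θ q) n                        ∎) ⟩
    where
    open SetoidReasoning setoid

  θ-neg : ∀ p → θ (negₚ p) ≋ negₚ (θ p)
  θ-neg p = ⟨ (λ n → begin
    coeff (θ (negₚ p)) n     ≈⟨ trans (coeff-θ (negₚ p) n) (*-congˡ (coeff-neg p n)) ⟩
    fromℕ n * - coeff p n    ≈⟨ -‿distribʳ-* _ _ ⟨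
    - (fromℕ n * coeff p n)  ≈⟨ trans (coeff-neg (θ p) n) (-‿cong (coeff-θ p n)) ⟨
    coeff (negₚ (θ p)) n     ∎) ⟩
    where
    open SetoidReasoning setoid

  θ-scale : ∀ a p → θ (scale a p) ≋ scale a (θ p)
  θ-scale a p = ⟨ (λ n → begin
    coeff (θ (scale a p)) n      ≈⟨ trans (coeff-θ (scale a p) n) (*-congˡ (coeff-scale a p n)) ⟩
    fromℕ n * (a * coeff p n)    ≈⟨ x∙yz≈y∙xz _ _ _ ⟩
    a * (fromℕ n * coeff p n)    ≈⟨ trans (coeff-scale a (θ p) n) (*-congˡ (coeff-θ p n)) ⟨
    coeff (scale a (θ p)) n      ∎) ⟩
    where
    open SetoidReasoning setoid
    open import Algebra.Properties.CommutativeSemigroup *-commutativeSemigroup using (x∙yz≈y∙xz)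

  θ-xₚ*ₚ : ∀ p → θ (xₚ *ₚ p) ≋ xₚ *ₚ (p +ₚ θ p)
  θ-xₚ*ₚ p = ≋-trans (θ-cong (≋-sym (0∷≋xₚ*ₚ p))) (0∷≋xₚ*ₚ (p +ₚ θ p))

  θ-* : ∀ p q → θ (p *ₚ q) ≋ θ p *ₚ q +ₚ p *ₚ θ q
  θ-* []      q = ≋-refl
  θ-* (a ∷ p) q = begin
    θ (scale a q +ₚ (0# ∷ (p *ₚ q)))
      ≈⟨ θ-+ (scale a q) (0# ∷ (p *ₚ q)) ⟩
    θ (scale a q) +ₚ θ (0# ∷ (p *ₚ q))
      ≈⟨ +ₚ-cong (≋-trans (θ-scale a q) (scale≋constₚ*ₚ a (θ q))) (≋-trans (θ-cong (0∷≋xₚ*ₚ (p *ₚ q))) (θ-xₚ*ₚ (p *ₚ q))) ⟩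
    A *ₚ θ q +ₚ xₚ *ₚ (p *ₚ q +ₚ θ (p *ₚ q))
      ≈⟨ +ₚ-congˡ (A *ₚ θ q) (*ₚ-congˡ xₚ (+ₚ-congˡ (p *ₚ q) (θ-* p q))) ⟩
    A *ₚ θ q +ₚ xₚ *ₚ (p *ₚ q +ₚ (θ p *ₚ q +ₚ p *ₚ θ q))
      ≈⟨ solve 6 (λ A x p q tp tq →
           A :* tq :+ x :* (p :* q :+ (tp :* q :+ p :* tq)) := (x :* (p :+ tp)) :* q :+ (A :+ x :* p) :* tq)
           ≋-refl A xₚ p q (θ p) (θ q) ⟩
    (xₚ *ₚ (p +ₚ θ p)) *ₚ q +ₚ (A +ₚ xₚ *ₚ p) *ₚ θ q
      ≈⟨ +ₚ-cong (*ₚ-congʳ q (0∷≋xₚ*ₚ (p +ₚ θ p))) (*ₚ-congʳ (θ q) (∷≋constₚ+xₚ*ₚ a p)) ⟨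
    θ (a ∷ p) *ₚ q +ₚ (a ∷ p) *ₚ θ q
      ∎
    where
    open ≋-Reasoning
    A = constₚ a

  θ-constₚ : ∀ a → θ (constₚ a) ≋ []
  θ-constₚ a = 0∷[]≋[]

  θ-xₚ : θ xₚ ≋ xₚ
  θ-xₚ = ⟨ (λ { zero → refl ; (suc zero) → +-identityʳ _ ; (suc (suc n)) → refl }) ⟩

  θ-U : θ U ≋ negₚ xₚ
  θ-U = ≋-trans (θ-+ 1ₚ (negₚ xₚ)) (+ₚ-cong (θ-constₚ 1#) (≋-trans (θ-neg xₚ) (negₚ-cong θ-xₚ)))

  θ-^ₚ : ∀ p n → θ (p ^ₚ suc n) ≋ constₚ (fromℕ (suc n)) *ₚ (θ p *ₚ p ^ₚ n)
  θ-^ₚ p zero = begin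
    θ (p *ₚ 1ₚ)                    ≈⟨ θ-* p 1ₚ ⟩
    θ p *ₚ 1ₚ +ₚ p *ₚ θ 1ₚ         ≈⟨ +ₚ-congˡ (θ p *ₚ 1ₚ) (*ₚ-congˡ p (θ-constₚ 1#)) ⟩
    θ p *ₚ 1ₚ +ₚ p *ₚ []           ≈⟨ solve 2 (λ tp p → tp :* Κ1 :+ p :* Κ0 := Κ1 :* (tp :* Κ1)) ≋-refl (θ p) p ⟩
    1ₚ *ₚ (θ p *ₚ 1ₚ)              ≈⟨ *ₚ-congʳ (θ p *ₚ 1ₚ) (constₚ-cong (sym (+-identityʳ 1#))) ⟩
    constₚ (fromℕ 1) *ₚ (θ p *ₚ 1ₚ) ∎
    where
    open ≋-Reasoning
    Κ0 = con (+ 0)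
    Κ1 = con (+ 1)
  θ-^ₚ p (suc n) = begin
    θ (p *ₚ p ^ₚ suc n)                             ≈⟨ θ-* p (p ^ₚ suc n) ⟩
    θ p *ₚ p ^ₚ suc n +ₚ p *ₚ θ (p ^ₚ suc n)         ≈⟨ +ₚ-congˡ (θ p *ₚ p ^ₚ suc n) (*ₚ-congˡ p (θ-^ₚ p n)) ⟩
    θ p *ₚ (p *ₚ p ^ₚ n) +ₚ p *ₚ (N *ₚ (θ p *ₚ p ^ₚ n))
      ≈⟨ solve 4 (λ tp p pn N → tp :* (p :* pn) :+ p :* (N :* (tp :* pn)) := (con (+ 1) :+ N) :* (tp :* (p :* pn)))
           ≋-refl (θ p) p (p ^ₚ n) N ⟩
    (1ₚ +ₚ N) *ₚ (θ p *ₚ (p *ₚ p ^ₚ n))             ∎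
    where
    open ≋-Reasoning
    N = constₚ (fromℕ (suc n))

  module Composition (g : Poly) where

    compose-+ : ∀ p q → compose (p +ₚ q) g ≋ compose p g +ₚ compose q g
    compose-+ []      q       = ≋-refl
    compose-+ (a ∷ p) []      = ≋-sym (+ₚ-identityʳ _)
    compose-+ (a ∷ p) (b ∷ q) = ≋-trans (+ₚ-congˡ (constₚ (a + b)) (*ₚ-congˡ g (compose-+ p q)))
      (solve 5 (λ A B g P Q → (A :+ B) :+ g :* (P :+ Q) := (A :+ g :* P) :+ (B :+ g :* Q))
        ≋-refl (constₚ a) (constₚ b) g (compose p g) (compose q g))

    compose-neg : ∀ p → compose (negₚ p) g ≋ negₚ (compose p g)
    compose-neg []      = ≋-refl
    compose-neg (a ∷ p) = ≋-trans (+ₚ-congˡ (constₚ (- a)) (*ₚ-congˡ g (compose-neg p)))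
      (solve 3 (λ A g P → (:- A) :+ g :* (:- P) := :- (A :+ g :* P)) ≋-refl (constₚ a) g (compose p g))

    compose-≋[] : ∀ {p} → p ≋ [] → compose p g ≋ []
    compose-≋[] {[]}    e = ≋-refl
    compose-≋[] {a ∷ p} e = ≋-trans
      (+ₚ-cong (≋-trans (constₚ-cong (at e 0)) 0∷[]≋[]) (*ₚ-congˡ g (compose-≋[] {p} ⟨ (λ n → at e (suc n)) ⟩)))
      (*ₚ-zeroʳ g)

    compose-cong : ∀ {p q} → p ≋ q → compose p g ≋ compose q g
    compose-cong {p} {q} e = ≋-by-difference (compose p g) (compose q g) (≋-trans
      (≋-sym (≋-trans (compose-+ p (negₚ q)) (+ₚ-congˡ (compose p g) (compose-neg q))))
      (compose-≋[] (≋-trans (+ₚ-congʳ (negₚ q) e) (negₚ-inverseʳ q))))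

    compose-constₚ : ∀ a → compose (constₚ a) g ≋ constₚ a
    compose-constₚ a = ≋-trans (+ₚ-congˡ (constₚ a) (*ₚ-zeroʳ g)) (+ₚ-identityʳ _)

    compose-scale : ∀ a p → compose (scale a p) g ≋ constₚ a *ₚ compose p g
    compose-scale a []      = ≋-sym (*ₚ-zeroʳ (constₚ a))
    compose-scale a (b ∷ p) = ≋-trans (+ₚ-cong (constₚ-* a b) (*ₚ-congˡ g (compose-scale a p)))
      (solve 4 (λ A B g P → A :* B :+ g :* (A :* P) := A :* (B :+ g :* P))
        ≋-refl (constₚ a) (constₚ b) g (compose p g))

    compose-* : ∀ p q → compose (p *ₚ q) g ≋ compose p g *ₚ compose q g
    compose-* []      q = ≋-refl
    compose-* (a ∷ p) q = ≋-trans (compose-+ (scale a q) (0# ∷ (p *ₚ q)))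
      (≋-trans (+ₚ-cong (compose-scale a q) (+ₚ-cong 0∷[]≋[] (*ₚ-congˡ g (compose-* p q))))
        (solve 4 (λ A g P Q → A :* Q :+ (con (+ 0) :+ g :* (P :* Q)) := (A :+ g :* P) :* Q)
          ≋-refl (constₚ a) g (compose p g) (compose q g)))

    compose-xₚ : compose xₚ g ≋ g
    compose-xₚ = ≋-trans (+ₚ-cong 0∷[]≋[] (*ₚ-congˡ g (compose-constₚ 1#))) (*ₚ-identityʳ g)

    compose-0∷ : ∀ p → compose (0# ∷ p) g ≋ g *ₚ compose p g
    compose-0∷ p = +ₚ-congʳ (g *ₚ compose p g) 0∷[]≋[]

    compose-^ₚ : ∀ p n → compose (p ^ₚ n) g ≋ compose p g ^ₚ n
    compose-^ₚ p zero    = compose-constₚ 1#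
    compose-^ₚ p (suc n) = ≋-trans (compose-* p (p ^ₚ n)) (*ₚ-congˡ (compose p g) (compose-^ₚ p n))

    compose-U : compose U g ≋ 1ₚ -ₚ g
    compose-U = ≋-trans (compose-+ 1ₚ (negₚ xₚ))
      (+ₚ-cong (compose-constₚ 1#) (≋-trans (compose-neg xₚ) (negₚ-cong compose-xₚ)))

  open Composition public

  ev₁ : Poly → Carrier
  ev₁ []      = 0#
  ev₁ (a ∷ p) = a + ev₁ p

  ev₁-+ : ∀ p q → ev₁ (p +ₚ q) ≈ ev₁ p + ev₁ q
  ev₁-+ []      q       = sym (+-identityˡ _)
  ev₁-+ (a ∷ p) []      = sym (+-identityʳ _)
  ev₁-+ (a ∷ p) (b ∷ q) = trans (+-congˡ (ev₁-+ p q)) (+-interchange a b (ev₁ p) (ev₁ q))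
    where
    open import Algebra.Properties.CommutativeSemigroup +-commutativeSemigroup using () renaming (interchange to +-interchange)

  ev₁-neg : ∀ p → ev₁ (negₚ p) ≈ - ev₁ p
  ev₁-neg []      = sym -0#≈0#
  ev₁-neg (a ∷ p) = trans (+-congˡ (ev₁-neg p)) (⁻¹-∙-comm _ _)

  ev₁-- : ∀ p q → ev₁ (p -ₚ q) ≈ ev₁ p - ev₁ q
  ev₁-- p q = trans (ev₁-+ p (negₚ q)) (+-congˡ (ev₁-neg q))

  ev₁-scale : ∀ a p → ev₁ (scale a p) ≈ a * ev₁ p
  ev₁-scale a []      = sym (zeroʳ _)
  ev₁-scale a (b ∷ p) = trans (+-congˡ (ev₁-scale a p)) (sym (distribˡ _ _ _))

  ev₁-≋[] : ∀ {p} → p ≋ [] → ev₁ p ≈ 0#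
  ev₁-≋[] {[]}    e = refl
  ev₁-≋[] {a ∷ p} e = trans (+-cong (at e 0) (ev₁-≋[] {p} ⟨ (λ n → at e (suc n)) ⟩)) (+-identityʳ _)

  ev₁-cong : ∀ {p q} → p ≋ q → ev₁ p ≈ ev₁ q
  ev₁-cong {p} {q} e = ≈-by-difference (ev₁ p) (ev₁ q)
    (trans (sym (ev₁-- p q)) (ev₁-≋[] (≋-trans (+ₚ-congʳ (negₚ q) e) (negₚ-inverseʳ q))))

  ev₁-* : ∀ p q → ev₁ (p *ₚ q) ≈ ev₁ p * ev₁ q
  ev₁-* []      q = sym (zeroˡ _)
  ev₁-* (a ∷ p) q = trans (ev₁-+ (scale a q) (0# ∷ (p *ₚ q)))
    (trans (+-cong (ev₁-scale a q) (trans (+-identityˡ _) (ev₁-* p q))) (sym (distribʳ _ _ _)))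

  ev₁-constₚ : ∀ a → ev₁ (constₚ a) ≈ a
  ev₁-constₚ a = +-identityʳ a

  ev₁-^ₚ : ∀ p n → ev₁ (p ^ₚ n) ≈ ev₁ p ^ n
  ev₁-^ₚ p zero    = ev₁-constₚ 1#
  ev₁-^ₚ p (suc n) = trans (ev₁-* p (p ^ₚ n)) (*-congˡ (ev₁-^ₚ p n))

  ev₁-compose : ∀ g → ev₁ g ≈ 1# → ∀ p → ev₁ (compose p g) ≈ ev₁ p
  ev₁-compose g g1 []      = refl
  ev₁-compose g g1 (a ∷ p) = trans (ev₁-+ (constₚ a) (g *ₚ compose p g))
    (+-cong (ev₁-constₚ a) (trans (ev₁-* g _) (trans (*-cong g1 (ev₁-compose g g1 p)) (*-identityˡ _))))

  ev₁-xₚ : ev₁ xₚ ≈ 1#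
  ev₁-xₚ = trans (+-identityˡ _) (+-identityʳ _)

  ev₁-U : ev₁ U ≈ 0#
  ev₁-U = trans (ev₁-- 1ₚ xₚ) (trans (+-cong (ev₁-constₚ 1#) (-‿cong ev₁-xₚ)) (-‿inverseʳ 1#))

  ev₁-U^ₚsuc*ₚ : ∀ d p → ev₁ (U ^ₚ suc d *ₚ p) ≈ 0#
  ev₁-U^ₚsuc*ₚ d p = begin
    ev₁ (U ^ₚ suc d *ₚ p)        ≈⟨ ev₁-* (U ^ₚ suc d) p ⟩
    ev₁ (U ^ₚ suc d) * ev₁ p     ≈⟨ *-congʳ (trans (ev₁-* U (U ^ₚ d)) (trans (*-congʳ ev₁-U) (zeroˡ (ev₁ (U ^ₚ d))))) ⟩
    0# * ev₁ p                   ≈⟨ zeroˡ (ev₁ p) ⟩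
    0#                           ∎
    where
    open SetoidReasoning setoid

  ev₁-monomial : ∀ m → ev₁ (monomial m) ≈ 1#
  ev₁-monomial zero    = +-identityʳ 1#
  ev₁-monomial (suc m) = trans (+-congˡ (ev₁-monomial m)) (+-identityˡ _)

  ev₁-geomSum : ∀ m → ev₁ (geomSum m) ≈ fromℕ m
  ev₁-geomSum zero    = refl
  ev₁-geomSum (suc m) = +-congˡ (ev₁-geomSum m)

  θ-monomial : ∀ m → θ (monomial m) ≋ constₚ (fromℕ m) *ₚ monomial m
  θ-monomial zero    = ≋-trans 0∷[]≋[] (≋-sym (*ₚ-congʳ 1ₚ 0∷[]≋[]))
  θ-monomial (suc m) = begin
    θ (0# ∷ X)               ≈⟨ ≋-trans (θ-cong (0∷≋xₚ*ₚ X)) (θ-xₚ*ₚ X) ⟩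
    xₚ *ₚ (X +ₚ θ X)         ≈⟨ *ₚ-congˡ xₚ (+ₚ-congˡ X (θ-monomial m)) ⟩
    xₚ *ₚ (X +ₚ M *ₚ X)      ≈⟨ solve 3 (λ x X M → x :* (X :+ M :* X) := (con (+ 1) :+ M) :* (x :* X)) ≋-refl xₚ X M ⟩
    (1ₚ +ₚ M) *ₚ (xₚ *ₚ X)   ≈⟨ *ₚ-congˡ (1ₚ +ₚ M) (0∷≋xₚ*ₚ X) ⟨
    (1ₚ +ₚ M) *ₚ (0# ∷ X)    ∎
    where
    open ≋-Reasoning
    X = monomial m
    M = constₚ (fromℕ m)

  U*geomSum : ∀ m → U *ₚ geomSum m ≋ 1ₚ -ₚ monomial m
  U*geomSum zero    = solve 1 (λ x → (con (+ 1) :- x) :* con (+ 0) := con (+ 1) :- con (+ 1)) ≋-refl xₚ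
  U*geomSum (suc m) = begin
    U *ₚ (1# ∷ G)              ≈⟨ *ₚ-congˡ U (∷≋constₚ+xₚ*ₚ 1# G) ⟩
    U *ₚ (1ₚ +ₚ xₚ *ₚ G)       ≈⟨ solve 2 (λ x G → (Κ1 :- x) :* (Κ1 :+ x :* G) := (Κ1 :- x) :+ x :* ((Κ1 :- x) :* G)) ≋-refl xₚ G ⟩
    U +ₚ xₚ *ₚ (U *ₚ G)        ≈⟨ +ₚ-congˡ U (*ₚ-congˡ xₚ (U*geomSum m)) ⟩
    U +ₚ xₚ *ₚ (1ₚ -ₚ X)       ≈⟨ solve 2 (λ x X → (Κ1 :- x) :+ x :* (Κ1 :- X) := Κ1 :- x :* X) ≋-refl xₚ X ⟩
    1ₚ -ₚ xₚ *ₚ X              ≈⟨ +ₚ-congˡ 1ₚ (negₚ-cong (0∷≋xₚ*ₚ X)) ⟨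
    1ₚ -ₚ monomial (suc m)     ∎
    where
    open ≋-Reasoning
    Κ1 = con (+ 1)
    G = geomSum m
    X = monomial m

  U*θgeomSum : ∀ m → U *ₚ θ (geomSum m) ≋ xₚ *ₚ geomSum m -ₚ constₚ (fromℕ m) *ₚ monomial m
  U*θgeomSum m = begin
    U *ₚ θ G
      ≈⟨ solve 4 (λ U G tU tG → U :* tG := (tU :* G :+ U :* tG) :- tU :* G) ≋-refl U G (θ U) (θ G) ⟩
    (θ U *ₚ G +ₚ U *ₚ θ G) -ₚ θ U *ₚ G
      ≈⟨ +ₚ-cong (≋-trans (≋-sym (θ-* U G)) (θ-cong (U*geomSum m))) (negₚ-cong (*ₚ-congʳ G θ-U)) ⟩
    θ (1ₚ -ₚ X) -ₚ negₚ xₚ *ₚ G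
      ≈⟨ +ₚ-congʳ (negₚ (negₚ xₚ *ₚ G)) (≋-trans (θ-+ 1ₚ (negₚ X)) (+ₚ-cong (θ-constₚ 1#) (≋-trans (θ-neg X) (negₚ-cong (θ-monomial m))))) ⟩
    ([] +ₚ negₚ (M *ₚ X)) -ₚ negₚ xₚ *ₚ G
      ≈⟨ solve 4 (λ x G M X → (con (+ 0) :+ :- (M :* X)) :- (:- x :* G) := x :* G :- M :* X) ≋-refl xₚ G M X ⟩
    xₚ *ₚ G -ₚ M *ₚ X
      ∎
    where
    open ≋-Reasoning
    G = geomSum m
    X = monomial m
    M = constₚ (fromℕ m)

  factor-U : ∀ p → ∃ λ q → p ≋ U *ₚ q +ₚ constₚ (ev₁ p)
  factor-U []      = [] , ≋-sym (+ₚ-cong (*ₚ-zeroʳ U) 0∷[]≋[])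
  factor-U (a ∷ p) with factor-U p
  ... | q , e = xₚ *ₚ q -ₚ E , (begin
    a ∷ p                          ≈⟨ ∷≋constₚ+xₚ*ₚ a p ⟩
    constₚ a +ₚ xₚ *ₚ p            ≈⟨ +ₚ-congˡ (constₚ a) (*ₚ-congˡ xₚ e) ⟩
    constₚ a +ₚ xₚ *ₚ (U *ₚ q +ₚ E)
      ≈⟨ solve 4 (λ A x q E → A :+ x :* ((Κ1 :- x) :* q :+ E) := (Κ1 :- x) :* (x :* q :- E) :+ (A :+ E))
           ≋-refl (constₚ a) xₚ q E ⟩
    U *ₚ (xₚ *ₚ q -ₚ E) +ₚ (constₚ a +ₚ E) ∎)
    where
    open ≋-Reasoning
    Κ1 = con (+ 1)
    E = constₚ (ev₁ p)

  U∣ₚ-root : ∀ {p} → ev₁ p ≈ 0# → U ∣ₚ p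
  U∣ₚ-root {p} p1 with factor-U p
  ... | q , e = q , ≋-trans e (≋-trans (+ₚ-congˡ (U *ₚ q) (≋-trans (constₚ-cong p1) 0∷[]≋[])) (+ₚ-identityʳ _))

  record DegreeBelow (N : ℕ) (p : Poly) : Set ℓ where
    constructor deg<
    field coeff-≥ : ∀ n → N ≤ n → coeff p n ≈ 0#
  open DegreeBelow public

  DegreeBelow-resp : ∀ {N p q} → p ≋ q → DegreeBelow N p → DegreeBelow N q
  DegreeBelow-resp e d = deg< (λ n N≤n → trans (sym (at e n)) (coeff-≥ d n N≤n))

  DegreeBelow-suc : ∀ {N p} → DegreeBelow N p → DegreeBelow (suc N) p
  DegreeBelow-suc {N} d = deg< (λ n N<n → coeff-≥ d n (ℕₚ.≤-trans (ℕₚ.n≤1+n N) N<n))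

  DegreeBelow-+ : ∀ {N p q} → DegreeBelow N p → DegreeBelow N q → DegreeBelow N (p +ₚ q)
  DegreeBelow-+ {N} {p} {q} d e = deg< (λ n N≤n →
    trans (coeff-+ p q n) (trans (+-cong (coeff-≥ d n N≤n) (coeff-≥ e n N≤n)) (+-identityʳ _)))

  DegreeBelow-neg : ∀ {N p} → DegreeBelow N p → DegreeBelow N (negₚ p)
  DegreeBelow-neg {N} {p} d = deg< (λ n N≤n → trans (coeff-neg p n) (trans (-‿cong (coeff-≥ d n N≤n)) -0#≈0#))

  DegreeBelow-θ : ∀ {N p} → DegreeBelow N p → DegreeBelow N (θ p)
  DegreeBelow-θ {N} {p} d = deg< (λ n N≤n → trans (coeff-θ p n) (trans (*-congˡ (coeff-≥ d n N≤n)) (zeroʳ _)))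

  coeff-constₚ*ₚ : ∀ a p n → coeff (constₚ a *ₚ p) n ≈ a * coeff p n
  coeff-constₚ*ₚ a p n = trans (at (≋-sym (scale≋constₚ*ₚ a p)) n) (coeff-scale a p n)

  DegreeBelow-constₚ*ₚ : ∀ {N p} a → DegreeBelow N p → DegreeBelow N (constₚ a *ₚ p)
  DegreeBelow-constₚ*ₚ {N} {p} a d = deg< (λ n N≤n →
    trans (coeff-constₚ*ₚ a p n) (trans (*-congˡ (coeff-≥ d n N≤n)) (zeroʳ _)))

  coeff-xₚ*ₚ-suc : ∀ p n → coeff (xₚ *ₚ p) (suc n) ≈ coeff p n
  coeff-xₚ*ₚ-suc p n = at (≋-sym (0∷≋xₚ*ₚ p)) (suc n)

  DegreeBelow-xₚ*ₚ : ∀ {N p} → DegreeBelow N p → DegreeBelow (suc N) (xₚ *ₚ p)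
  DegreeBelow-xₚ*ₚ {N} {p} d = DegreeBelow-resp (0∷≋xₚ*ₚ p) (deg< (λ { (suc n) (s≤s N≤n) → coeff-≥ d n N≤n }))

  U*ₚ≋-0∷ : ∀ p → U *ₚ p ≋ p -ₚ (0# ∷ p)
  U*ₚ≋-0∷ p = ≋-trans (solve 2 (λ x p → (con (+ 1) :- x) :* p := p :- x :* p) ≋-refl xₚ p)
    (+ₚ-congˡ p (negₚ-cong (≋-sym (0∷≋xₚ*ₚ p))))

  coeff-U*ₚ-suc : ∀ p n → coeff (U *ₚ p) (suc n) ≈ coeff p (suc n) - coeff p n
  coeff-U*ₚ-suc p n = trans (at (U*ₚ≋-0∷ p) (suc n)) (coeff-- p (0# ∷ p) (suc n))

  DegreeBelow-U*ₚ : ∀ {N p} → DegreeBelow N p → DegreeBelow (suc N) (U *ₚ p)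
  DegreeBelow-U*ₚ {N} {p} d = DegreeBelow-resp (≋-sym (U*ₚ≋-0∷ p))
    (DegreeBelow-+ (DegreeBelow-suc d) (DegreeBelow-neg (DegreeBelow-resp (≋-sym (0∷≋xₚ*ₚ p)) (DegreeBelow-xₚ*ₚ d))))

  coeff-≥length : ∀ p n → length p ≤ n → coeff p n ≡ 0#
  coeff-≥length []      n       _         = ≡.refl
  coeff-≥length (a ∷ p) (suc n) (s≤s len≤n) = coeff-≥length p n len≤n

  -- From N on the coefficients of p are constant, hence zero since p is a finite list.
  DegreeBelow-U*ₚ⁻¹ : ∀ {N p} → DegreeBelow (suc N) (U *ₚ p) → DegreeBelow N p
  DegreeBelow-U*ₚ⁻¹ {N} {p} d = deg< (λ n N≤n → trans (constant-from n N≤n (length p))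
    (reflexive (coeff-≥length p (n ℕ.+ length p) (ℕₚ.m≤n+m (length p) n))))
    where
    successive : ∀ k → N ≤ k → coeff p k ≈ coeff p (suc k)
    successive k N≤k = sym (≈-by-difference _ _ (trans (sym (coeff-U*ₚ-suc p k)) (coeff-≥ d (suc k) (s≤s N≤k))))
    constant-from : ∀ n → N ≤ n → ∀ k → coeff p n ≈ coeff p (n ℕ.+ k)
    constant-from n N≤n zero    = reflexive (≡.cong (coeff p) (≡.sym (ℕₚ.+-identityʳ n)))
    constant-from n N≤n (suc k) = trans (constant-from n N≤n k) (trans
      (successive (n ℕ.+ k) (ℕₚ.≤-trans N≤n (ℕₚ.m≤m+n n k)))
      (reflexive (≡.cong (coeff p) (≡.sym (ℕₚ.+-suc n k)))))

  U^ₚ*ₚ-DegreeBelow : ∀ k {p} → DegreeBelow k (U ^ₚ k *ₚ p) → p ≋ []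
  U^ₚ*ₚ-DegreeBelow zero    {p} d = ⟨ (λ n → trans (sym (at (*ₚ-identityˡ p) n)) (coeff-≥ d n z≤n)) ⟩
  U^ₚ*ₚ-DegreeBelow (suc k) {p} d = U^ₚ*ₚ-DegreeBelow k (DegreeBelow-U*ₚ⁻¹ (DegreeBelow-resp (*ₚ-assoc U (U ^ₚ k) p) d))

  U*ₚ-cancel : ∀ {p} → U *ₚ p ≋ [] → p ≋ []
  U*ₚ-cancel {p} e = ⟨ vanish ⟩
    where
    vanish : ∀ n → coeff p n ≈ 0#
    vanish zero    = trans (sym (trans (at (U*ₚ≋-0∷ p) 0) (trans (coeff-- p (0# ∷ p) 0)
      (trans (+-congˡ -0#≈0#) (+-identityʳ _))))) (at e 0)
    vanish (suc n) = trans (≈-by-difference _ _ (trans (sym (coeff-U*ₚ-suc p n)) (at e (suc n)))) (vanish n)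

  U^ₚ*ₚ-cancel : ∀ j {p q} → U ^ₚ j *ₚ p ≋ U ^ₚ j *ₚ q → p ≋ q
  U^ₚ*ₚ-cancel zero    {p} {q} e = ≋-trans (≋-sym (*ₚ-identityˡ p)) (≋-trans e (*ₚ-identityˡ q))
  U^ₚ*ₚ-cancel (suc j) {p} {q} e = U^ₚ*ₚ-cancel j (≋-by-difference (W *ₚ p) (W *ₚ q) (U*ₚ-cancel (begin
    U *ₚ (W *ₚ p -ₚ W *ₚ q)
      ≈⟨ solve 3 (λ U A B → U :* (A :- B) := U :* A :- U :* B) ≋-refl U (W *ₚ p) (W *ₚ q) ⟩
    U *ₚ (W *ₚ p) -ₚ U *ₚ (W *ₚ q)
      ≈⟨ +ₚ-cong (≋-sym (*ₚ-assoc U W p)) (negₚ-cong (≋-sym (*ₚ-assoc U W q))) ⟩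
    U ^ₚ suc j *ₚ p -ₚ U ^ₚ suc j *ₚ q
      ≈⟨ ≋-trans (+ₚ-congʳ (negₚ (U ^ₚ suc j *ₚ q)) e) (negₚ-inverseʳ (U ^ₚ suc j *ₚ q)) ⟩
    [] ∎)))
    where
    open ≋-Reasoning
    W = U ^ₚ j

  coeff-monic-top : ∀ {l} (cs : Vec Carrier l) → coeff (monic l cs) l ≡ 1#
  coeff-monic-top Vec.[]       = ≡.refl
  coeff-monic-top (a Vec.∷ cs) = coeff-monic-top cs

  monic-DegreeBelow : ∀ {l} (cs : Vec Carrier l) → DegreeBelow (suc l) (monic l cs)
  monic-DegreeBelow cs = deg< (λ n l<n → reflexive (vanishes cs n l<n))
    where
    vanishes : ∀ {l} (cs : Vec Carrier l) n → suc l ≤ n → coeff (monic l cs) n ≡ 0#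
    vanishes Vec.[]       (suc n) _         = ≡.refl
    vanishes (a Vec.∷ cs) (suc n) (s≤s l<n) = vanishes cs n l<n

module EulerianPolynomials {c ℓ} (R : CommutativeRing c ℓ) where
  open CommutativeRing R
  open PolyOver R
  open PolynomialCalculus R
  open IntegerSolver R using (fromℕ-*)

  -- Applying θ to A_l / (1 - x)^(l+1) gives A_(l+1) = (1 - x) θ A_l + (l + 1) x A_l.
  eulerian : ℕ → Poly
  eulerian zero    = 1ₚ
  eulerian (suc l) = U *ₚ θ (eulerian l) +ₚ constₚ (fromℕ (suc l)) *ₚ (xₚ *ₚ eulerian l)

  record AgreeBelow (N : ℕ) (p q : Poly) : Set ℓ where
    constructor agree<
    field coeff-< : ∀ n → n < N → coeff p n ≈ coeff q n
  open AgreeBelow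

  ≋⇒AgreeBelow : ∀ {N p q} → p ≋ q → AgreeBelow N p q
  ≋⇒AgreeBelow e = agree< (λ n _ → at e n)

  AgreeBelow-resp : ∀ {N p p′ q q′} → p ≋ p′ → q ≋ q′ → AgreeBelow N p q → AgreeBelow N p′ q′
  AgreeBelow-resp e f a = agree< (λ n n<N → trans (sym (at e n)) (trans (coeff-< a n n<N) (at f n)))

  AgreeBelow-+ : ∀ {N p p′ q q′} → AgreeBelow N p p′ → AgreeBelow N q q′ → AgreeBelow N (p +ₚ q) (p′ +ₚ q′)
  AgreeBelow-+ {N} {p} {p′} {q} {q′} a b = agree< (λ n n<N →
    trans (coeff-+ p q n) (trans (+-cong (coeff-< a n n<N) (coeff-< b n n<N)) (sym (coeff-+ p′ q′ n))))

  AgreeBelow-θ : ∀ {N p q} → AgreeBelow N p q → AgreeBelow N (θ p) (θ q)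
  AgreeBelow-θ {N} {p} {q} a = agree< (λ n n<N →
    trans (coeff-θ p n) (trans (*-congˡ (coeff-< a n n<N)) (sym (coeff-θ q n))))

  AgreeBelow-scale : ∀ {N p q} b → AgreeBelow N p q → AgreeBelow N (scale b p) (scale b q)
  AgreeBelow-scale {N} {p} {q} b a = agree< (λ n n<N →
    trans (coeff-scale b p n) (trans (*-congˡ (coeff-< a n n<N)) (sym (coeff-scale b q n))))

  AgreeBelow-∷ : ∀ {N p q} b → AgreeBelow N p q → AgreeBelow (suc N) (b ∷ p) (b ∷ q)
  AgreeBelow-∷ b a = agree< (λ { zero _ → refl ; (suc n) (s≤s n<N) → coeff-< a n n<N })

  AgreeBelow-pred : ∀ {N p q} → AgreeBelow (suc N) p q → AgreeBelow N p q
  AgreeBelow-pred a = agree< (λ n n<N → coeff-< a n (ℕₚ.m≤n⇒m≤1+n n<N))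

  AgreeBelow-*ₚˡ : ∀ {N p q} r → AgreeBelow N p q → AgreeBelow N (r *ₚ p) (r *ₚ q)
  AgreeBelow-*ₚˡ []      a = agree< (λ n _ → refl)
  AgreeBelow-*ₚˡ (b ∷ r) a = AgreeBelow-+ (AgreeBelow-scale b a) (AgreeBelow-pred (AgreeBelow-∷ 0# (AgreeBelow-*ₚˡ r a)))

  sumUpTo-cong : ∀ n {f g : ℕ → Carrier} → (∀ j → j ≤ n → f j ≈ g j) → sumUpTo n f ≈ sumUpTo n g
  sumUpTo-cong zero    e = e 0 z≤n
  sumUpTo-cong (suc n) e = +-cong (sumUpTo-cong n (λ j j≤n → e j (ℕₚ.m≤n⇒m≤1+n j≤n))) (e (suc n) ℕₚ.≤-refl)

  sumUpTo-zero : ∀ n (f : ℕ → Carrier) → (∀ j → f j ≈ 0#) → sumUpTo n f ≈ 0#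
  sumUpTo-zero zero    f e = e 0
  sumUpTo-zero (suc n) f e = trans (+-cong (sumUpTo-zero n f e) (e (suc n))) (+-identityʳ _)

  sumUpTo-suc : ∀ n (f : ℕ → Carrier) → sumUpTo (suc n) f ≈ f 0 + sumUpTo n (λ j → f (suc j))
  sumUpTo-suc zero    f = refl
  sumUpTo-suc (suc n) f = trans (+-congʳ (sumUpTo-suc n f)) (+-assoc _ _ _)

  coeff-*ₚ : ∀ p q n → coeff (p *ₚ q) n ≈ sumUpTo n (λ j → coeff p j * coeff q (n ℕ.∸ j))
  coeff-*ₚ []      q n       = sym (sumUpTo-zero n _ (λ j → zeroˡ _))
  coeff-*ₚ (a ∷ p) q zero    = trans (coeff-+ (scale a q) (0# ∷ (p *ₚ q)) 0) (trans (+-identityʳ _) (coeff-scale a q 0))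
  coeff-*ₚ (a ∷ p) q (suc n) = trans (coeff-+ (scale a q) (0# ∷ (p *ₚ q)) (suc n))
    (trans (+-cong (coeff-scale a q (suc n)) (coeff-*ₚ p q n))
      (sym (sumUpTo-suc n (λ j → coeff (a ∷ p) j * coeff q (suc n ℕ.∸ j)))))

  truncation : (ℕ → Carrier) → ℕ → Poly
  truncation f zero    = []
  truncation f (suc N) = f 0 ∷ truncation (λ k → f (suc k)) N

  coeff-truncation-< : ∀ f N k → k < N → coeff (truncation f N) k ≡ f k
  coeff-truncation-< f (suc N) zero    _         = ≡.refl
  coeff-truncation-< f (suc N) (suc k) (s≤s k<N) = coeff-truncation-< (λ k → f (suc k)) N k k<N

  coeff-truncation-≥ : ∀ f N k → N ≤ k → coeff (truncation f N) k ≡ 0#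
  coeff-truncation-≥ f zero    k       _         = ≡.refl
  coeff-truncation-≥ f (suc N) (suc k) (s≤s N≤k) = coeff-truncation-≥ (λ k → f (suc k)) N k N≤k

  truncation-cong : ∀ {f g : ℕ → Carrier} N → (∀ k → f k ≈ g k) → truncation f N ≋ truncation g N
  truncation-cong zero    e = ≋-refl
  truncation-cong (suc N) e = ∷-cong (e 0) (truncation-cong N (λ k → e (suc k)))

  θ-truncation : ∀ f N → θ (truncation f N) ≋ truncation (λ k → fromℕ k * f k) N
  θ-truncation f N = ⟨ (λ n → trans (coeff-θ (truncation f N) n) (θ-coeff n)) ⟩
    where
    θ-coeff : ∀ n → fromℕ n * coeff (truncation f N) n ≈ coeff (truncation (λ k → fromℕ k * f k) N) n
    θ-coeff n with n ℕ.<? N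
    ... | yes n<N = trans (*-congˡ (reflexive (coeff-truncation-< f N n n<N)))
                          (reflexive (≡.sym (coeff-truncation-< _ N n n<N)))
    ... | no  n≮N = trans (*-congˡ (reflexive (coeff-truncation-≥ f N n (ℕₚ.≮⇒≥ n≮N))))
                          (trans (zeroʳ _) (reflexive (≡.sym (coeff-truncation-≥ _ N n (ℕₚ.≮⇒≥ n≮N)))))

  powerSeries : ℕ → ℕ → Poly
  powerSeries l N = truncation (λ k → fromℕ (k ℕ.^ l)) N

  eulerianSeries : ℕ → ℕ → Poly
  eulerianSeries l N = oneMinusX ^ₚ suc l *ₚ powerSeries l N

  θ-powerSeries : ∀ l N → θ (powerSeries l N) ≋ powerSeries (suc l) N
  θ-powerSeries l N = ≋-trans (θ-truncation _ N) (truncation-cong N (λ k → sym (fromℕ-* k (k ℕ.^ l))))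

  eulerianSeries-suc : ∀ l N →
    eulerianSeries (suc l) N ≋ U *ₚ θ (eulerianSeries l N) +ₚ constₚ (fromℕ (suc l)) *ₚ (xₚ *ₚ eulerianSeries l N)
  eulerianSeries-suc l N = ≋-sym (begin
    U *ₚ θ (eulerianSeries l N) +ₚ M *ₚ (xₚ *ₚ eulerianSeries l N)
      ≈⟨ +ₚ-cong (*ₚ-congˡ U (θ-cong E≋)) (*ₚ-congˡ M (*ₚ-congˡ xₚ E≋)) ⟩
    U *ₚ θ ((U *ₚ W) *ₚ T) +ₚ M *ₚ (xₚ *ₚ ((U *ₚ W) *ₚ T))
      ≈⟨ +ₚ-congʳ (M *ₚ (xₚ *ₚ ((U *ₚ W) *ₚ T))) (*ₚ-congˡ U (≋-trans (θ-* (U *ₚ W) T)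
           (+ₚ-congʳ ((U *ₚ W) *ₚ θ T) (*ₚ-congʳ T (≋-trans (θ-^ₚ U l) (*ₚ-congˡ M (*ₚ-congʳ W θ-U))))))) ⟩
    U *ₚ ((M *ₚ (negₚ xₚ *ₚ W)) *ₚ T +ₚ (U *ₚ W) *ₚ θ T) +ₚ M *ₚ (xₚ *ₚ ((U *ₚ W) *ₚ T))
      ≈⟨ solve 6 (λ U x W T tT M →
           U :* ((M :* (:- x :* W)) :* T :+ (U :* W) :* tT) :+ M :* (x :* ((U :* W) :* T)) := (U :* (U :* W)) :* tT)
           ≋-refl U xₚ W T (θ T) M ⟩
    (U *ₚ (U *ₚ W)) *ₚ θ T
      ≈⟨ ≋-trans (*ₚ-congʳ (θ T) (≋-sym (^ₚ-cong (suc (suc l)) oneMinusX≋U))) (*ₚ-congˡ (oneMinusX ^ₚ suc (suc l)) (θ-powerSeries l N)) ⟩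
    eulerianSeries (suc l) N ∎)
    where
    open ≋-Reasoning
    M = constₚ (fromℕ (suc l))
    W = U ^ₚ l
    T = powerSeries l N
    E≋ : eulerianSeries l N ≋ (U *ₚ W) *ₚ T
    E≋ = *ₚ-congʳ T (^ₚ-cong (suc l) oneMinusX≋U)

  -- (1 - x)(c + c x + ... + c x^(N-1)) = c - c x^N.
  constₚ-AgreeBelow-U*ₚtruncation : ∀ b N → AgreeBelow N (constₚ b) (U *ₚ truncation (λ _ → b) N)
  constₚ-AgreeBelow-U*ₚtruncation b zero    = agree< (λ n ())
  constₚ-AgreeBelow-U*ₚtruncation b (suc N) =
    AgreeBelow-resp (≋-trans (+ₚ-congˡ B 0∷[]≋[]) (+ₚ-identityʳ B)) (≋-sym U*ₚb∷T)
      (AgreeBelow-+ (≋⇒AgreeBelow {p = B} ≋-refl) (AgreeBelow-∷ 0# D-AgreeBelow-[]))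
    where
    B = constₚ b
    T = truncation (λ _ → b) N
    D = U *ₚ T -ₚ B
    D-AgreeBelow-[] : AgreeBelow N [] D
    D-AgreeBelow-[] = AgreeBelow-resp (negₚ-inverseʳ B) ≋-refl
      (AgreeBelow-+ (constₚ-AgreeBelow-U*ₚtruncation b N) (≋⇒AgreeBelow {p = negₚ B} ≋-refl))
    U*ₚb∷T : U *ₚ (b ∷ T) ≋ B +ₚ (0# ∷ D)
    U*ₚb∷T = begin
      U *ₚ (b ∷ T)          ≈⟨ *ₚ-congˡ U (∷≋constₚ+xₚ*ₚ b T) ⟩
      U *ₚ (B +ₚ xₚ *ₚ T)    ≈⟨ solve 3 (λ x B T → (con (+ 1) :- x) :* (B :+ x :* T) := B :+ x :* ((con (+ 1) :- x) :* T :- B))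
                                 ≋-refl xₚ B T ⟩
      B +ₚ xₚ *ₚ D           ≈⟨ +ₚ-congˡ B (0∷≋xₚ*ₚ D) ⟨
      B +ₚ (0# ∷ D)          ∎
      where
      open ≋-Reasoning

  eulerian-AgreeBelow-eulerianSeries : ∀ l N → AgreeBelow N (eulerian l) (eulerianSeries l N)
  eulerian-AgreeBelow-eulerianSeries zero N =
    AgreeBelow-resp (constₚ-cong (+-identityʳ 1#)) (≋-sym (*ₚ-congʳ (powerSeries 0 N) (*ₚ-identityʳ oneMinusX)))
      (AgreeBelow-resp ≋-refl (*ₚ-congʳ (powerSeries 0 N) (≋-sym oneMinusX≋U)) (constₚ-AgreeBelow-U*ₚtruncation (fromℕ 1) N))
  eulerian-AgreeBelow-eulerianSeries (suc l) N = AgreeBelow-resp ≋-refl (≋-sym (eulerianSeries-suc l N))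
    (AgreeBelow-+ (AgreeBelow-*ₚˡ U (AgreeBelow-θ (eulerian-AgreeBelow-eulerianSeries l N)))
                  (AgreeBelow-*ₚˡ (constₚ (fromℕ (suc l))) (AgreeBelow-*ₚˡ xₚ (eulerian-AgreeBelow-eulerianSeries l N))))

  coeff-eulerian : ∀ l n → coeff (eulerian l) n ≈ eulerianCoeff l n
  coeff-eulerian l n = begin
    coeff (eulerian l) n
      ≈⟨ coeff-< (eulerian-AgreeBelow-eulerianSeries l (suc n)) n ℕₚ.≤-refl ⟩
    coeff (eulerianSeries l (suc n)) n
      ≈⟨ coeff-*ₚ (oneMinusX ^ₚ suc l) (powerSeries l (suc n)) n ⟩
    sumUpTo n (λ j → coeff (oneMinusX ^ₚ suc l) j * coeff (powerSeries l (suc n)) (n ℕ.∸ j))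
      ≈⟨ sumUpTo-cong n (λ j _ → *-congˡ (reflexive
           (coeff-truncation-< (λ k → fromℕ (k ℕ.^ l)) (suc n) (n ℕ.∸ j) (s≤s (ℕₚ.m∸n≤m n j))))) ⟩
    eulerianCoeff l n ∎
    where
    open SetoidReasoning setoid

  IsEulerian⇒≋eulerian : ∀ l f → IsEulerian l f → f ≋ eulerian l
  IsEulerian⇒≋eulerian l f f≈A = ⟨ (λ n → trans (f≈A n) (sym (coeff-eulerian l n))) ⟩

  ≋eulerian⇒IsEulerian : ∀ l f → f ≋ eulerian l → IsEulerian l f
  ≋eulerian⇒IsEulerian l f f≋A n = trans (at f≋A n) (coeff-eulerian l n)

  eulerian-DegreeBelow : ∀ l → DegreeBelow (suc l) (eulerian l)
  eulerian-DegreeBelow zero    = deg< (λ { (suc n) _ → refl })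
  eulerian-DegreeBelow (suc l) = DegreeBelow-+ (DegreeBelow-U*ₚ (DegreeBelow-θ (eulerian-DegreeBelow l)))
    (DegreeBelow-constₚ*ₚ _ (DegreeBelow-xₚ*ₚ (eulerian-DegreeBelow l)))

  coeff-eulerian-top : ∀ l → coeff (eulerian l) l ≈ 1#
  coeff-eulerian-top zero    = refl
  coeff-eulerian-top (suc l) = begin
    coeff (U *ₚ θ A +ₚ M *ₚ (xₚ *ₚ A)) (suc l)
      ≈⟨ coeff-+ (U *ₚ θ A) (M *ₚ (xₚ *ₚ A)) (suc l) ⟩
    coeff (U *ₚ θ A) (suc l) + coeff (M *ₚ (xₚ *ₚ A)) (suc l)
      ≈⟨ +-cong (coeff-U*ₚ-suc (θ A) l) (trans (coeff-constₚ*ₚ _ (xₚ *ₚ A) (suc l)) (*-congˡ (coeff-xₚ*ₚ-suc A l))) ⟩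
    (coeff (θ A) (suc l) - coeff (θ A) l) + fromℕ (suc l) * coeff A l
      ≈⟨ +-cong (+-cong (trans (coeff-θ A (suc l)) (trans (*-congˡ (coeff-≥ (eulerian-DegreeBelow l) (suc l) ℕₚ.≤-refl)) (zeroʳ _)))
                        (-‿cong (trans (coeff-θ A l) (trans (*-congˡ (coeff-eulerian-top l)) (*-identityʳ _)))))
                (trans (*-congˡ (coeff-eulerian-top l)) (*-identityʳ _)) ⟩
    (0# - fromℕ l) + (1# + fromℕ l)
      ≈⟨ trans (+-congʳ (+-identityˡ _)) (+-comm _ _) ⟩
    (1# + fromℕ l) - fromℕ l
      ≈⟨ trans (+-congʳ (+-comm 1# _)) (xyx⁻¹≈y (fromℕ l) 1#) ⟩
    1# ∎
    where
    open SetoidReasoning setoid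
    open import Algebra.Properties.AbelianGroup +-abelianGroup using (xyx⁻¹≈y)
    A = eulerian l
    M = constₚ (fromℕ (suc l))

module EulerianCongruence {c ℓ} (R : CommutativeRing c ℓ) (m : ℕ) (minv : CR.Carrier R)
  (m*minv≈1 : CR._≈_ R (CR._*_ R (PolyOver.fromℕ R m) minv) (CR.1# R)) where
  open CommutativeRing R
  open PolyOver R
  open PolynomialCalculus R
  open EulerianPolynomials R using (eulerian; IsEulerian⇒≋eulerian)
  open import Algebra.Definitions.RawSemiring (Semiring.rawSemiring semiring) using (_^_)

  X G P K Mm : Poly
  X  = monomial m
  G  = geomSum m
  P  = scale minv G
  K  = constₚ minv
  Mm = constₚ (fromℕ m)

  Solves : ℕ → Poly → Set (c ⊔ ℓ)
  Solves l f = U ^ₚ suc l ∣ₚ compose f X -ₚ P ^ₚ suc l *ₚ f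

  Solves-resp : ∀ {l f g} → f ≋ g → Solves l f → Solves l g
  Solves-resp {l} f≋g (r , e) =
    r , ≋-trans (+ₚ-cong (compose-cong X (≋-sym f≋g)) (negₚ-cong (*ₚ-congˡ (P ^ₚ suc l) (≋-sym f≋g)))) e

  Cong⇒Solves : ∀ {l f} → Cong l f m minv → Solves l f
  Cong⇒Solves {l} (r , e) = r , ≋-trans ⟨ e ⟩ (*ₚ-congʳ r (^ₚ-cong (suc l) oneMinusX≋U))

  Solves⇒Cong : ∀ {l f} → Solves l f → Cong l f m minv
  Solves⇒Cong {l} (r , e) = r , at (≋-trans e (*ₚ-congʳ r (^ₚ-cong (suc l) (≋-sym oneMinusX≋U))))

  K*G≋P : K *ₚ G ≋ P
  K*G≋P = ≋-sym (scale≋constₚ*ₚ minv G)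

  K*Mm : K *ₚ Mm ≋ 1ₚ
  K*Mm = ≋-trans (≋-sym (constₚ-* minv (fromℕ m))) (constₚ-cong (trans (*-comm _ _) m*minv≈1))

  ev₁-P : ev₁ P ≈ 1#
  ev₁-P = trans (ev₁-scale minv G) (trans (*-congˡ (ev₁-geomSum m)) (trans (*-comm _ _) m*minv≈1))

  compose-U-monomial : compose U X ≋ U *ₚ G
  compose-U-monomial = ≋-trans (compose-U X) (≋-sym (U*geomSum m))

  θ-compose-monomial : ∀ p → θ (compose p X) ≋ Mm *ₚ compose (θ p) X
  θ-compose-monomial []      = ≋-sym (*ₚ-zeroʳ Mm)
  θ-compose-monomial (b ∷ p) = begin
    θ (constₚ b +ₚ X *ₚ compose p X)
      ≈⟨ θ-+ (constₚ b) (X *ₚ compose p X) ⟩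
    θ (constₚ b) +ₚ θ (X *ₚ compose p X)
      ≈⟨ +ₚ-cong (θ-constₚ b) (≋-trans (θ-* X (compose p X))
           (+ₚ-cong (*ₚ-congʳ (compose p X) (θ-monomial m)) (*ₚ-congˡ X (θ-compose-monomial p)))) ⟩
    [] +ₚ ((Mm *ₚ X) *ₚ compose p X +ₚ X *ₚ (Mm *ₚ compose (θ p) X))
      ≈⟨ solve 4 (λ M X Cp Ct → con (+ 0) :+ ((M :* X) :* Cp :+ X :* (M :* Ct)) := M :* (X :* (Cp :+ Ct)))
           ≋-refl Mm X (compose p X) (compose (θ p) X) ⟩
    Mm *ₚ (X *ₚ (compose p X +ₚ compose (θ p) X))
      ≈⟨ *ₚ-congˡ Mm (≋-trans (*ₚ-congˡ X (≋-sym (compose-+ X p (θ p)))) (≋-sym (compose-0∷ X (p +ₚ θ p)))) ⟩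
    Mm *ₚ compose (θ (b ∷ p)) X ∎
    where
    open ≋-Reasoning

  Solves-1ₚ : Solves 0 1ₚ
  Solves-1ₚ with U∣ₚ-root {compose 1ₚ X -ₚ P ^ₚ 1 *ₚ 1ₚ} ev₁-difference
    where
    ev₁-difference : ev₁ (compose 1ₚ X -ₚ P ^ₚ 1 *ₚ 1ₚ) ≈ 0#
    ev₁-difference = begin
      ev₁ (compose 1ₚ X -ₚ P ^ₚ 1 *ₚ 1ₚ)   ≈⟨ ev₁-- (compose 1ₚ X) (P ^ₚ 1 *ₚ 1ₚ) ⟩
      ev₁ (compose 1ₚ X) - ev₁ (P ^ₚ 1 *ₚ 1ₚ)
        ≈⟨ +-cong (ev₁-compose X (ev₁-monomial m) 1ₚ) (-‿cong (trans (ev₁-* (P ^ₚ 1) 1ₚ) (*-cong (ev₁-^ₚ P 1) (ev₁-constₚ 1#)))) ⟩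
      ev₁ 1ₚ - (ev₁ P * 1#) * 1#           ≈⟨ +-cong (ev₁-constₚ 1#) (-‿cong (trans (*-identityʳ _) (trans (*-identityʳ _) ev₁-P))) ⟩
      1# - 1#                               ≈⟨ -‿inverseʳ 1# ⟩
      0# ∎
      where
      open SetoidReasoning setoid
  ... | q , e = q , ≋-trans e (*ₚ-congʳ q (≋-sym (*ₚ-identityʳ U)))

  compose-eulerianStep : ∀ b a →
    compose (U *ₚ θ a +ₚ constₚ b *ₚ (xₚ *ₚ a)) X ≋ (U *ₚ G) *ₚ (K *ₚ θ (compose a X)) +ₚ constₚ b *ₚ (X *ₚ compose a X)
  compose-eulerianStep b a = ≋-trans (compose-+ X (U *ₚ θ a) (constₚ b *ₚ (xₚ *ₚ a))) (+ₚ-cong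
    (≋-trans (compose-* X U (θ a)) (≋-trans (*ₚ-congʳ _ compose-U-monomial) (*ₚ-congˡ (U *ₚ G) compose-θ)))
    (≋-trans (compose-* X (constₚ b) (xₚ *ₚ a)) (≋-trans (*ₚ-congʳ _ (compose-constₚ X b))
      (*ₚ-congˡ (constₚ b) (≋-trans (compose-* X xₚ a) (*ₚ-congʳ _ (compose-xₚ X)))))))
    where
    compose-θ : compose (θ a) X ≋ K *ₚ θ (compose a X)
    compose-θ = ≋-sym (≋-trans (*ₚ-congˡ K (θ-compose-monomial a))
      (≋-trans (≋-sym (*ₚ-assoc K Mm _)) (≋-trans (*ₚ-congʳ _ K*Mm) (*ₚ-identityˡ _))))

  θ-P^ₚ : ∀ l → θ (P ^ₚ suc l) ≋ constₚ (fromℕ (suc l)) *ₚ ((K *ₚ θ G) *ₚ P ^ₚ l)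
  θ-P^ₚ l = ≋-trans (θ-^ₚ P l) (*ₚ-congˡ (constₚ (fromℕ (suc l))) (*ₚ-congʳ (P ^ₚ l) (≋-trans (θ-scale minv G) (scale≋constₚ*ₚ minv (θ G)))))

  θ-U^ₚ : ∀ l → θ (U ^ₚ suc l) ≋ constₚ (fromℕ (suc l)) *ₚ (negₚ xₚ *ₚ U ^ₚ l)
  θ-U^ₚ l = ≋-trans (θ-^ₚ U l) (*ₚ-congˡ (constₚ (fromℕ (suc l))) (*ₚ-congʳ (U ^ₚ l) θ-U))

  θ-P^ₚ*ₚ+U^ₚ*ₚ : ∀ l a r → θ (P ^ₚ suc l *ₚ a +ₚ U ^ₚ suc l *ₚ r) ≋
    let M = constₚ (fromℕ (suc l)) in
    (M *ₚ ((K *ₚ θ G) *ₚ P ^ₚ l)) *ₚ a +ₚ ((K *ₚ G) *ₚ P ^ₚ l) *ₚ θ a +ₚ (M *ₚ (negₚ xₚ *ₚ U ^ₚ l)) *ₚ r +ₚ U ^ₚ suc l *ₚ θ r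
  θ-P^ₚ*ₚ+U^ₚ*ₚ l a r = ≋-trans (θ-+ (P ^ₚ suc l *ₚ a) (U ^ₚ suc l *ₚ r)) (≋-trans
    (+ₚ-cong (≋-trans (θ-* (P ^ₚ suc l) a) (+ₚ-cong (*ₚ-congʳ a (θ-P^ₚ l)) (*ₚ-congʳ (θ a) (*ₚ-congʳ (P ^ₚ l) (≋-sym K*G≋P)))))
             (≋-trans (θ-* (U ^ₚ suc l) r) (+ₚ-congʳ _ (*ₚ-congʳ r (θ-U^ₚ l)))))
    (≋-sym (+ₚ-assoc (M *ₚ ((K *ₚ θ G) *ₚ P ^ₚ l) *ₚ a +ₚ ((K *ₚ G) *ₚ P ^ₚ l) *ₚ θ a) ((M *ₚ (negₚ xₚ *ₚ U ^ₚ l)) *ₚ r) (U ^ₚ suc l *ₚ θ r))))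
    where M = constₚ (fromℕ (suc l))

  -- Both sides of the step identity differ by a multiple of this, which vanishes since (1 - x) θG = xG - mX and m·minv = 1.
  eulerianStep-remainder≋[] : K *ₚ (U *ₚ θ G -ₚ (xₚ *ₚ G -ₚ Mm *ₚ X)) +ₚ X *ₚ (1ₚ -ₚ K *ₚ Mm) ≋ []
  eulerianStep-remainder≋[] = ≋-trans
    (+ₚ-cong (≋-trans (*ₚ-congˡ K (≋-trans (+ₚ-congʳ _ (U*θgeomSum m)) (negₚ-inverseʳ (xₚ *ₚ G -ₚ Mm *ₚ X)))) (*ₚ-zeroʳ K))
             (≋-trans (*ₚ-congˡ X (≋-trans (+ₚ-congˡ 1ₚ (negₚ-cong K*Mm)) (negₚ-inverseʳ 1ₚ))) (*ₚ-zeroʳ X)))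
    ≋-refl

  Solves-eulerianStep : ∀ l a → Solves l a → Solves (suc l) (U *ₚ θ a +ₚ constₚ (fromℕ (suc l)) *ₚ (xₚ *ₚ a))
  Solves-eulerianStep l a (r , Ca-Pa≋Ur) = r′ , ≋+ₚ⇒-ₚ≋ (begin
    compose a′ X
      ≈⟨ compose-eulerianStep (fromℕ (suc l)) a ⟩
    (U *ₚ G) *ₚ (K *ₚ θ Y) +ₚ M *ₚ (X *ₚ Y)
      ≈⟨ +ₚ-cong (*ₚ-congˡ (U *ₚ G) (*ₚ-congˡ K (≋-trans (θ-cong Y≋) (θ-P^ₚ*ₚ+U^ₚ*ₚ l a r)))) (*ₚ-congˡ M (*ₚ-congˡ X Y≋′)) ⟩
    (U *ₚ G) *ₚ (K *ₚ ((M *ₚ ((K *ₚ θ G) *ₚ Q)) *ₚ a +ₚ ((K *ₚ G) *ₚ Q) *ₚ θ a +ₚ (M *ₚ (negₚ xₚ *ₚ W)) *ₚ r +ₚ (U *ₚ W) *ₚ θ r))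
      +ₚ M *ₚ (X *ₚ (((K *ₚ G) *ₚ Q) *ₚ a +ₚ (U *ₚ W) *ₚ r))
      ≈⟨ solve 14 (λ U x G X a ta r tr tG W Q K Mm M →
           (U :* G) :* (K :* ((M :* ((K :* tG) :* Q)) :* a :+ ((K :* G) :* Q) :* ta :+ (M :* (:- x :* W)) :* r :+ (U :* W) :* tr))
             :+ M :* (X :* (((K :* G) :* Q) :* a :+ (U :* W) :* r))
           := ((K :* G) :* ((K :* G) :* Q)) :* (U :* ta :+ M :* (x :* a)) :+ (U :* (U :* W)) :* (K :* (G :* tr :- M :* (r :* tG)))
             :+ (M :* (K :* (G :* (Q :* a))) :+ M :* (U :* (W :* r)))
                :* (K :* (U :* tG :- (x :* G :- Mm :* X)) :+ X :* (con (+ 1) :- K :* Mm)))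
           ≋-refl U xₚ G X a (θ a) r (θ r) (θ G) W Q K Mm M ⟩
    RHS +ₚ Z *ₚ (K *ₚ (U *ₚ θ G -ₚ (xₚ *ₚ G -ₚ Mm *ₚ X)) +ₚ X *ₚ (1ₚ -ₚ K *ₚ Mm))
      ≈⟨ +ₚ-congˡ RHS (≋-trans (*ₚ-congˡ Z eulerianStep-remainder≋[]) (*ₚ-zeroʳ Z)) ⟩
    RHS +ₚ []
      ≈⟨ ≋-trans (+ₚ-identityʳ RHS) (+ₚ-congʳ _ (*ₚ-congʳ a′ (*ₚ-cong K*G≋P (*ₚ-congʳ Q K*G≋P)))) ⟩
    P ^ₚ suc (suc l) *ₚ a′ +ₚ U ^ₚ suc (suc l) *ₚ r′ ∎)
    where
    open ≋-Reasoning
    M = constₚ (fromℕ (suc l))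
    Q = P ^ₚ l
    W = U ^ₚ l
    Y = compose a X
    a′ = U *ₚ θ a +ₚ M *ₚ (xₚ *ₚ a)
    r′ = K *ₚ (G *ₚ θ r -ₚ M *ₚ (r *ₚ θ G))
    Z = M *ₚ (K *ₚ (G *ₚ (Q *ₚ a))) +ₚ M *ₚ (U *ₚ (W *ₚ r))
    RHS = ((K *ₚ G) *ₚ ((K *ₚ G) *ₚ Q)) *ₚ a′ +ₚ (U *ₚ (U *ₚ W)) *ₚ r′
    Y≋ : Y ≋ P ^ₚ suc l *ₚ a +ₚ U ^ₚ suc l *ₚ r
    Y≋ = -ₚ≋⇒≋+ₚ Ca-Pa≋Ur
    Y≋′ : Y ≋ ((K *ₚ G) *ₚ Q) *ₚ a +ₚ (U *ₚ W) *ₚ r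
    Y≋′ = ≋-trans Y≋ (+ₚ-congʳ _ (*ₚ-congʳ a (*ₚ-congʳ Q (≋-sym K*G≋P))))

  eulerian-Solves : ∀ l → Solves l (eulerian l)
  eulerian-Solves zero    = Solves-1ₚ
  eulerian-Solves (suc l) = Solves-eulerianStep l (eulerian l) (eulerian-Solves l)

  Solves-+ : ∀ {l f g} → Solves l f → Solves l g → Solves l (f +ₚ g)
  Solves-+ {l} {f} {g} (r , e) (s , e′) = r +ₚ s , (begin
    compose (f +ₚ g) X -ₚ Q *ₚ (f +ₚ g)            ≈⟨ +ₚ-congʳ _ (compose-+ X f g) ⟩
    (compose f X +ₚ compose g X) -ₚ Q *ₚ (f +ₚ g)
      ≈⟨ solve 5 (λ Cf Cg Q f g → (Cf :+ Cg) :- Q :* (f :+ g) := (Cf :- Q :* f) :+ (Cg :- Q :* g))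
           ≋-refl (compose f X) (compose g X) Q f g ⟩
    (compose f X -ₚ Q *ₚ f) +ₚ (compose g X -ₚ Q *ₚ g) ≈⟨ +ₚ-cong e e′ ⟩
    U ^ₚ suc l *ₚ r +ₚ U ^ₚ suc l *ₚ s            ≈⟨ *ₚ-distribˡ (U ^ₚ suc l) r s ⟨
    U ^ₚ suc l *ₚ (r +ₚ s)                        ∎)
    where
    open ≋-Reasoning
    Q = P ^ₚ suc l

  Solves-neg : ∀ {l f} → Solves l f → Solves l (negₚ f)
  Solves-neg {l} {f} (r , e) = negₚ r , (begin
    compose (negₚ f) X -ₚ Q *ₚ negₚ f     ≈⟨ +ₚ-congʳ _ (compose-neg X f) ⟩
    negₚ (compose f X) -ₚ Q *ₚ negₚ f
      ≈⟨ solve 3 (λ Cf Q f → :- Cf :- Q :* (:- f) := :- (Cf :- Q :* f)) ≋-refl (compose f X) Q f ⟩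
    negₚ (compose f X -ₚ Q *ₚ f)          ≈⟨ negₚ-cong e ⟩
    negₚ (U ^ₚ suc l *ₚ r)                ≈⟨ solve 2 (λ V r → :- (V :* r) := V :* (:- r)) ≋-refl (U ^ₚ suc l) r ⟩
    U ^ₚ suc l *ₚ negₚ r                  ∎)
    where
    open ≋-Reasoning
    Q = P ^ₚ suc l

  Solves-constₚ*ₚ : ∀ {l f} b → Solves l f → Solves l (constₚ b *ₚ f)
  Solves-constₚ*ₚ {l} {f} b (r , e) = B *ₚ r , (begin
    compose (B *ₚ f) X -ₚ Q *ₚ (B *ₚ f)   ≈⟨ +ₚ-congʳ _ (≋-trans (compose-* X B f) (*ₚ-congʳ _ (compose-constₚ X b))) ⟩
    B *ₚ compose f X -ₚ Q *ₚ (B *ₚ f)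
      ≈⟨ solve 4 (λ B Cf Q f → B :* Cf :- Q :* (B :* f) := B :* (Cf :- Q :* f)) ≋-refl B (compose f X) Q f ⟩
    B *ₚ (compose f X -ₚ Q *ₚ f)          ≈⟨ *ₚ-congˡ B e ⟩
    B *ₚ (U ^ₚ suc l *ₚ r)                ≈⟨ solve 3 (λ B V r → B :* (V :* r) := V :* (B :* r)) ≋-refl B (U ^ₚ suc l) r ⟩
    U ^ₚ suc l *ₚ (B *ₚ r)                ∎)
    where
    open ≋-Reasoning
    B = constₚ b
    Q = P ^ₚ suc l

  compose-U^ₚ*ₚ : ∀ J w → compose (U ^ₚ J *ₚ w) X ≋ U ^ₚ J *ₚ (G ^ₚ J *ₚ compose w X)
  compose-U^ₚ*ₚ J w = begin
    compose (U ^ₚ J *ₚ w) X                ≈⟨ compose-* X (U ^ₚ J) w ⟩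
    compose (U ^ₚ J) X *ₚ compose w X      ≈⟨ *ₚ-congʳ _ (≋-trans (compose-^ₚ X U J) (^ₚ-cong J compose-U-monomial)) ⟩
    (U *ₚ G) ^ₚ J *ₚ compose w X           ≈⟨ *ₚ-congʳ _ (^ₚ-distrib-*ₚ U G J) ⟩
    (U ^ₚ J *ₚ G ^ₚ J) *ₚ compose w X      ≈⟨ *ₚ-assoc (U ^ₚ J) (G ^ₚ J) _ ⟩
    U ^ₚ J *ₚ (G ^ₚ J *ₚ compose w X)      ∎
    where
    open ≋-Reasoning

  -- As compose U X = U G, the factor U^J cancels from the congruence for U^J w.
  Solves-U^ₚ*ₚ : ∀ {l} J d w → J ℕ.+ suc d ≡ suc l → Solves l (U ^ₚ J *ₚ w) →
                 U ^ₚ suc d ∣ₚ G ^ₚ J *ₚ compose w X -ₚ P ^ₚ suc l *ₚ w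
  Solves-U^ₚ*ₚ {l} J d w J+d≡l (r , e) = r , U^ₚ*ₚ-cancel J (begin
    U ^ₚ J *ₚ (G ^ₚ J *ₚ compose w X -ₚ Q *ₚ w)
      ≈⟨ solve 4 (λ V A Q w → V :* (A :- Q :* w) := V :* A :- Q :* (V :* w)) ≋-refl (U ^ₚ J) (G ^ₚ J *ₚ compose w X) Q w ⟩
    U ^ₚ J *ₚ (G ^ₚ J *ₚ compose w X) -ₚ Q *ₚ (U ^ₚ J *ₚ w)
      ≈⟨ +ₚ-congʳ _ (≋-sym (compose-U^ₚ*ₚ J w)) ⟩
    compose (U ^ₚ J *ₚ w) X -ₚ Q *ₚ (U ^ₚ J *ₚ w)
      ≈⟨ e ⟩
    U ^ₚ suc l *ₚ r
      ≈⟨ *ₚ-congʳ r (≡.subst (λ n → U ^ₚ n ≋ U ^ₚ J *ₚ U ^ₚ suc d) J+d≡l (^ₚ-homo-+ U J (suc d))) ⟩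
    (U ^ₚ J *ₚ U ^ₚ suc d) *ₚ r
      ≈⟨ *ₚ-assoc (U ^ₚ J) (U ^ₚ suc d) r ⟩
    U ^ₚ J *ₚ (U ^ₚ suc d *ₚ r) ∎)
    where
    open ≋-Reasoning
    Q = P ^ₚ suc l

  ev₁-G^ₚ*ₚcompose-P^ₚ*ₚ : ∀ J L w → ev₁ (G ^ₚ J *ₚ compose w X -ₚ P ^ₚ L *ₚ w) ≈ (fromℕ m ^ J - 1#) * ev₁ w
  ev₁-G^ₚ*ₚcompose-P^ₚ*ₚ J L w = begin
    ev₁ (G ^ₚ J *ₚ compose w X -ₚ P ^ₚ L *ₚ w)
      ≈⟨ ev₁-- (G ^ₚ J *ₚ compose w X) (P ^ₚ L *ₚ w) ⟩
    ev₁ (G ^ₚ J *ₚ compose w X) - ev₁ (P ^ₚ L *ₚ w)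
      ≈⟨ +-cong (ev₁-* (G ^ₚ J) (compose w X)) (-‿cong (ev₁-* (P ^ₚ L) w)) ⟩
    ev₁ (G ^ₚ J) * ev₁ (compose w X) - ev₁ (P ^ₚ L) * ev₁ w
      ≈⟨ +-cong (*-cong (trans (ev₁-^ₚ G J) (^-congˡ J (ev₁-geomSum m))) (ev₁-compose X (ev₁-monomial m) w))
                (-‿cong (*-congʳ (trans (ev₁-^ₚ P L) (trans (^-congˡ L ev₁-P) (1#^≈1# L))))) ⟩
    fromℕ m ^ J * ev₁ w - 1# * ev₁ w
      ≈⟨ +-congˡ (-‿distribˡ-* 1# (ev₁ w)) ⟩
    fromℕ m ^ J * ev₁ w + - 1# * ev₁ w
      ≈⟨ distribʳ (ev₁ w) (fromℕ m ^ J) (- 1#) ⟨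
    (fromℕ m ^ J - 1#) * ev₁ w ∎
    where
    open SetoidReasoning setoid
    open import Algebra.Properties.Ring ring using (-‿distribˡ-*)
    open import Algebra.Properties.Semiring.Exp semiring using (^-congˡ)
    1#^≈1# : ∀ n → 1# ^ n ≈ 1#
    1#^≈1# zero    = refl
    1#^≈1# (suc n) = trans (*-identityˡ _) (1#^≈1# n)

  IsEulerian⇒Cong : ∀ l f → IsEulerian l f → Cong l f m minv
  IsEulerian⇒Cong l f f≈A = Solves⇒Cong {l} (Solves-resp {l} (≋-sym (IsEulerian⇒≋eulerian l f f≈A)) (eulerian-Solves l))

module Uniqueness {c ℓ} (F : CharZeroField c ℓ) where
  open CharZeroField F
  open CommutativeRing commutativeRing
  open PolyOver commutativeRing
  open PolynomialCalculus commutativeRing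
  open EulerianPolynomials commutativeRing
  open IntegerSolver commutativeRing using (fromℕ-*)
  open import Algebra.Definitions.RawSemiring (Semiring.rawSemiring semiring) using (_^_)
  open SetoidReasoning setoid
  open import Algebra.Properties.Ring ring using (-0#≈0#)

  *-cancelˡ-≉0 : ∀ {a b} → ¬ a ≈ 0# → a * b ≈ 0# → b ≈ 0#
  *-cancelˡ-≉0 {a} {b} a≉0 ab≈0 with inverse a a≉0
  ... | a⁻¹ , aa⁻¹≈1 = begin
    b               ≈⟨ *-identityˡ b ⟨
    1# * b          ≈⟨ *-congʳ (trans (*-comm a⁻¹ a) aa⁻¹≈1) ⟨
    (a⁻¹ * a) * b   ≈⟨ *-assoc a⁻¹ a b ⟩
    a⁻¹ * (a * b)   ≈⟨ *-congˡ ab≈0 ⟩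
    a⁻¹ * 0#        ≈⟨ zeroʳ a⁻¹ ⟩
    0#              ∎

  fromℕ-^ : ∀ m j → fromℕ (m ℕ.^ j) ≈ fromℕ m ^ j
  fromℕ-^ m zero    = +-identityʳ 1#
  fromℕ-^ m (suc j) = trans (fromℕ-* m (m ℕ.^ j)) (*-congˡ (fromℕ-^ m j))

  fromℕ^suc-1≉0 : ∀ m → 2 ≤ m → ∀ j → ¬ fromℕ m ^ suc j - 1# ≈ 0#
  fromℕ^suc-1≉0 (suc zero)      (s≤s ()) j
  fromℕ^suc-1≉0 m@(suc (suc _)) 2≤m j m^-1≈0 with ℕₚ.m≤n⇒∃[o]m+o≡n 2≤m^
    where
    2≤m^ : 2 ≤ m ℕ.^ suc j
    2≤m^ = ℕₚ.≤-trans 2≤m (ℕₚ.m≤m*n m (m ℕ.^ j) {{ℕₚ.m^n≢0 m j}})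
  ... | k , 2+k≡m^ = charZero k (begin
    fromℕ (suc k)                          ≈⟨ xyx⁻¹≈y 1# (fromℕ (suc k)) ⟨
    fromℕ (2 ℕ.+ k) - 1#                   ≈⟨ +-congʳ (trans (reflexive (≡.cong fromℕ 2+k≡m^)) (fromℕ-^ m (suc j))) ⟩
    fromℕ m ^ suc j - 1#                   ≈⟨ m^-1≈0 ⟩
    0#                                     ∎)
    where
    open import Algebra.Properties.AbelianGroup +-abelianGroup using (xyx⁻¹≈y)

  module _ (m : ℕ) (2≤m : 2 ≤ m) (minv : Carrier) (m*minv≈1 : fromℕ m * minv ≈ 1#) (l : ℕ) where
    open EulerianCongruence commutativeRing m minv m*minv≈1

    U^ₚ∣ₚ-Solves-step : ∀ {p} → Solves l p → ∀ j d → j ℕ.+ suc d ≡ l → U ^ₚ suc j ∣ₚ p → U ^ₚ suc (suc j) ∣ₚ p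
    U^ₚ∣ₚ-Solves-step {p} sp j d j+d≡l (w , p≋) = w′ , ≋-trans p≋ (≋-trans (*ₚ-congˡ (U ^ₚ suc j) w≋)
      (solve 3 (λ V U w → V :* (U :* w) := (U :* V) :* w) ≋-refl (U ^ₚ suc j) U w′))
      where
      J = suc j
      quotient : U ^ₚ suc d ∣ₚ G ^ₚ J *ₚ compose w X -ₚ P ^ₚ suc l *ₚ w
      quotient = Solves-U^ₚ*ₚ J d w (≡.cong suc j+d≡l) (Solves-resp {l} p≋ sp)
      ev₁w≈0 : ev₁ w ≈ 0#
      ev₁w≈0 = *-cancelˡ-≉0 (fromℕ^suc-1≉0 m 2≤m j) (begin
        (fromℕ m ^ J - 1#) * ev₁ w                        ≈⟨ ev₁-G^ₚ*ₚcompose-P^ₚ*ₚ J (suc l) w ⟨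
        ev₁ (G ^ₚ J *ₚ compose w X -ₚ P ^ₚ suc l *ₚ w)    ≈⟨ ev₁-cong (proj₂ quotient) ⟩
        ev₁ (U ^ₚ suc d *ₚ proj₁ quotient)                 ≈⟨ ev₁-U^ₚsuc*ₚ d (proj₁ quotient) ⟩
        0#                                                 ∎)
      w′ : Poly
      w′ = proj₁ (U∣ₚ-root {w} ev₁w≈0)
      w≋ : w ≋ U *ₚ w′
      w≋ = proj₂ (U∣ₚ-root {w} ev₁w≈0)

    U^ₚ∣ₚ-Solves : ∀ {p} → Solves l p → ev₁ p ≈ 0# → ∀ k → k ≤ l → U ^ₚ suc k ∣ₚ p
    U^ₚ∣ₚ-Solves {p} sp p1≈0 zero    _ with U∣ₚ-root {p} p1≈0
    ... | q , p≋ = q , ≋-trans p≋ (*ₚ-congʳ q (≋-sym (*ₚ-identityʳ U)))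
    U^ₚ∣ₚ-Solves {p} sp p1≈0 (suc k) k<l = U^ₚ∣ₚ-Solves-step sp k (l ℕ.∸ suc k) k+d≡l
      (U^ₚ∣ₚ-Solves sp p1≈0 k (ℕₚ.≤-trans (ℕₚ.n≤1+n k) k<l))
      where
      k+d≡l : k ℕ.+ suc (l ℕ.∸ suc k) ≡ l
      k+d≡l = ≡.trans (ℕₚ.+-suc k (l ℕ.∸ suc k)) (ℕₚ.m+[n∸m]≡n k<l)

    Solves-root⇒≋[] : ∀ {p} → Solves l p → ev₁ p ≈ 0# → DegreeBelow (suc l) p → p ≋ []
    Solves-root⇒≋[] {p} sp p1≈0 deg with U^ₚ∣ₚ-Solves sp p1≈0 l ℕₚ.≤-refl
    ... | q , p≋ = ≋-trans p≋ (≋-trans (*ₚ-congˡ (U ^ₚ suc l) (U^ₚ*ₚ-DegreeBelow (suc l) (DegreeBelow-resp p≋ deg)))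
                                       (*ₚ-zeroʳ (U ^ₚ suc l)))

    -- u = h(1) A_l - A_l(1) h is a solution vanishing at 1, so u = 0; its x^l coefficient is h(1).
    Solves-top⇒≋[] : ∀ {h} → Solves l h → DegreeBelow (suc l) h → coeff h l ≈ 0# → h ≋ []
    Solves-top⇒≋[] {h} sh deg top≈0 = Solves-root⇒≋[] sh h1≈0 deg
      where
      A = eulerian l
      u = constₚ (ev₁ h) *ₚ A -ₚ constₚ (ev₁ A) *ₚ h
      u≋[] : u ≋ []
      u≋[] = Solves-root⇒≋[]
        (Solves-+ {l} (Solves-constₚ*ₚ {l} (ev₁ h) (eulerian-Solves l)) (Solves-neg {l} (Solves-constₚ*ₚ {l} (ev₁ A) sh)))
        (begin
          ev₁ u                                                   ≈⟨ ev₁-- (constₚ (ev₁ h) *ₚ A) (constₚ (ev₁ A) *ₚ h) ⟩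
          ev₁ (constₚ (ev₁ h) *ₚ A) - ev₁ (constₚ (ev₁ A) *ₚ h)   ≈⟨ +-cong (ev₁-* (constₚ (ev₁ h)) A) (-‿cong (ev₁-* (constₚ (ev₁ A)) h)) ⟩
          ev₁ (constₚ (ev₁ h)) * ev₁ A - ev₁ (constₚ (ev₁ A)) * ev₁ h
            ≈⟨ +-cong (*-congʳ (ev₁-constₚ _)) (-‿cong (*-congʳ (ev₁-constₚ _))) ⟩
          ev₁ h * ev₁ A - ev₁ A * ev₁ h                           ≈⟨ +-congˡ (-‿cong (*-comm (ev₁ A) (ev₁ h))) ⟩
          ev₁ h * ev₁ A - ev₁ h * ev₁ A                           ≈⟨ -‿inverseʳ _ ⟩
          0#                                                      ∎)
        (DegreeBelow-+ (DegreeBelow-constₚ*ₚ _ (eulerian-DegreeBelow l)) (DegreeBelow-neg (DegreeBelow-constₚ*ₚ _ deg)))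
      h1≈0 : ev₁ h ≈ 0#
      h1≈0 = begin
        ev₁ h                                  ≈⟨ trans (+-congˡ -0#≈0#) (trans (+-identityʳ _) (*-identityʳ _)) ⟨
        ev₁ h * 1# - 0#                        ≈⟨ +-cong (*-congˡ (coeff-eulerian-top l)) (-‿cong (trans (*-congˡ top≈0) (zeroʳ _))) ⟨
        ev₁ h * coeff A l - ev₁ A * coeff h l  ≈⟨ trans (coeff-- (constₚ (ev₁ h) *ₚ A) (constₚ (ev₁ A) *ₚ h) l)
                                                (+-cong (coeff-constₚ*ₚ (ev₁ h) A l) (-‿cong (coeff-constₚ*ₚ (ev₁ A) h l))) ⟨
        coeff u l                              ≈⟨ at u≋[] l ⟩
        0#                                     ∎

    monic-Solves⇒IsEulerian : ∀ (cs : Vec Carrier l) → Solves l (monic l cs) → IsEulerian l (monic l cs)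
    monic-Solves⇒IsEulerian cs sf = ≋eulerian⇒IsEulerian l f (≋-by-difference f A (Solves-top⇒≋[]
      (Solves-+ {l} sf (Solves-neg {l} (eulerian-Solves l)))
      (DegreeBelow-+ (monic-DegreeBelow cs) (DegreeBelow-neg (eulerian-DegreeBelow l)))
      (begin
        coeff (f -ₚ A) l      ≈⟨ coeff-- f A l ⟩
        coeff f l - coeff A l ≈⟨ +-cong (reflexive (coeff-monic-top cs)) (-‿cong (coeff-eulerian-top l)) ⟩
        1# - 1#               ≈⟨ -‿inverseʳ 1# ⟩
        0#                    ∎)))
      where
      f = monic l cs
      A = eulerian l

    Cong⇒IsEulerian : ∀ (cs : Vec Carrier l) → Cong l (monic l cs) m minv → IsEulerian l (monic l cs)
    Cong⇒IsEulerian cs cong = monic-Solves⇒IsEulerian cs (Cong⇒Solves {l} cong)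

  ½ : Carrier
  ½ = proj₁ (inverse (fromℕ 2) (charZero 1))

  2*½≈1 : fromℕ 2 * ½ ≈ 1#
  2*½≈1 = proj₂ (inverse (fromℕ 2) (charZero 1))

theorem5p1 : ∀ {c ℓ'} (F : CharZeroField c ℓ') →
  let open CharZeroField F
      open CommutativeRing commutativeRing
      open PolyOver commutativeRing
  in (ℓ : ℕ) → 1 ≤ ℓ → (cs : Vec Carrier ℓ) →
     let f = monic ℓ cs in
     (IsEulerian ℓ f ⇔ (∀ (m : ℕ) → 2 ≤ m → ∀ (minv : Carrier) → fromℕ m * minv ≈ 1# → Cong ℓ f m minv))
     × (IsEulerian ℓ f ⇔ Σ ℕ (λ m → 2 ≤ m × Σ Carrier (λ minv → fromℕ m * minv ≈ 1# × Cong ℓ f m minv)))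
     × (IsEulerian ℓ f ⇔ (∀ (hinv : Carrier) → fromℕ 2 * hinv ≈ 1# → Cong ℓ f 2 hinv))
theorem5p1 F l _ cs =
    mk⇔ (λ f≈A m _ minv h → eulerian-Cong f≈A m minv h)
        (λ cong → Cong⇒IsEulerian 2 2≤2 ½ 2*½≈1 l cs (cong 2 2≤2 ½ 2*½≈1))
  , mk⇔ (λ f≈A → 2 , 2≤2 , ½ , 2*½≈1 , eulerian-Cong f≈A 2 ½ 2*½≈1)
        (λ { (m , 2≤m , minv , h , cong) → Cong⇒IsEulerian m 2≤m minv h l cs cong })
  , mk⇔ (λ f≈A minv h → eulerian-Cong f≈A 2 minv h)
        (λ cong → Cong⇒IsEulerian 2 2≤2 ½ 2*½≈1 l cs (cong ½ 2*½≈1))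
  where
  open CharZeroField F
  open CommutativeRing commutativeRing
  open PolyOver commutativeRing
  open Uniqueness F
  2≤2 : 2 ≤ 2
  2≤2 = ℕₚ.≤-refl
  eulerian-Cong : IsEulerian l (monic l cs) → ∀ m minv → fromℕ m * minv ≈ 1# → Cong l (monic l cs) m minv
  eulerian-Cong f≈A m minv h = EulerianCongruence.IsEulerian⇒Cong commutativeRing m minv h l (monic l cs) f≈A
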